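{- Let $n\geq 2$ be an even integer and let $p$ be a prime. (i) If $p\equiv\pm1\pmod n$, $p>n+1$, and $c_1\neq c_2$ are elements of $\mathbb{F}_p$ such that $T_n(x)-c_1$ and $T_n(x)-c_2$ both split completely over $\mathbb{F}_p$, then letting $A$ and $B$ be the multisets of roots (counted with multiplicity) over $\mathbb{F}_p$ of $T_n(x)-c_1$ and $T_n(x)-c_2$ respectively, the pair $(A,B)$ is a symmetric ideal Prouhet–Tarry–Escott solution of size $n$ in $\mathbb{F}_p$. (ii) If $p\equiv 1\pmod n$, let $a\in\mathbb{F}_p$ have multiplicative order $n$ and set $r=(p-1)/n$. Then there exist $r$ distinct integers $s\in[0,p-1)$, including $s=0$, such that $A=\{1,a,\ldots,a^{n-1}\}$ and $B=sA$ form a symmetric ideal Prouhet–Tarry–Escott solution of size $n$ in $\mathbb{F}_p$.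
   Context: $T_n(x)\in\mathbb{Z}[x]$ denotes the $n$th Chebyshev polynomial of the first kind, defined by $T_n(\cos\theta)=\cos(n\theta)$, reduced modulo $p$. An ideal Prouhet–Tarry–Escott (PTE) solution of size $n$ in $\mathbb{F}_p$ is a pair of disjoint multisets $A=\{a_1,\ldots,a_n\}$, $B=\{b_1,\ldots,b_n\}$ of elements of $\mathbb{F}_p$ (no element of $A$ equals an element of $B$) such that $\sum_{i=1}^n a_i^k=\sum_{i=1}^n b_i^k$ in $\mathbb{F}_p$ for all $1\leq k\leq n-1$. For even $n$, such a solution is called symmetric if $A=-A$ and $B=-B$ as multisets. For $s\in\mathbb{F}_p$, $sA$ denotes the multiset $\{sa: a\in A\}$ (so $0\cdot A$ is the multiset consisting of $n$ copies of $0$). -}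

module Defs where

open import Data.Nat as ℕ using (ℕ; zero; suc; _∸_; _<_; _≤_)
open import Data.Nat.DivMod as DM using ()
open import Data.Integer as ℤ using (ℤ; +_; -_)
open import Data.Integer.Divisibility as ℤD using ()
open import Data.List using (List; []; _∷_; map; length)
open import Data.Nat.ListAction using (sum)
open import Data.List.Relation.Unary.All using (All)
open import Data.List.Membership.Propositional using (_∈_)
open import Data.List.Relation.Binary.Permutation.Propositional using (_↭_)
open import Data.Product using (Σ; _×_)
open import Relation.Binary.PropositionalEquality using (_≡_; _≢_)
open import Relation.Nullary using (¬_)

-- Arithmetic in F_p.  Elements of F_p are represented canonically by
-- natural numbers a < p; a multiset of elements of F_p is a List ℕ
-- (with entries < p) considered up to permutation (_↭_).

-- total remainder: m mod p (p is a prime in all uses, so p ≠ 0)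
_mod_ : ℕ → ℕ → ℕ
m mod zero = m
m mod suc k = m DM.% suc k

negp : ℕ → ℕ → ℕ
negp p zero = zero
negp p (suc a) = p ∸ suc a

scale : ℕ → ℕ → List ℕ → List ℕ
scale p s A = map (λ a → (s ℕ.* a) mod p) A

powSum : ℕ → ℕ → List ℕ → ℕ
powSum p k A = (sum (map (λ a → a ℕ.^ k) A)) mod p

record IdealPTE (p n : ℕ) (A B : List ℕ) : Set where
  field
    A-inFp   : All (_< p) A
    B-inFp   : All (_< p) B
    sizeA    : length A ≡ n
    sizeB    : length B ≡ n
    disjoint : ∀ {a b} → a ∈ A → b ∈ B → a ≢ b
    powers   : ∀ k → 1 ≤ k → k < n → powSum p k A ≡ powSum p k B

record SymIdealPTE (p n : ℕ) (A B : List ℕ) : Set where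
  field
    ideal : IdealPTE p n A B
    symA  : map (negp p) A ↭ A
    symB  : map (negp p) B ↭ B

HasOrder : ℕ → ℕ → ℕ → Set
HasOrder p a n = a < p × ((a ℕ.^ n) mod p ≡ 1) ×
                 (∀ k → 1 ≤ k → k < n → (a ℕ.^ k) mod p ≢ 1)

-- Polynomials in ℤ[x] as ascending coefficient lists.

Poly : Set
Poly = List ℤ

_+ₚ_ : Poly → Poly → Poly
[] +ₚ g = g
(a ∷ f) +ₚ [] = a ∷ f
(a ∷ f) +ₚ (b ∷ g) = (a ℤ.+ b) ∷ (f +ₚ g)

scalarₚ : ℤ → Poly → Poly
scalarₚ c f = map (c ℤ.*_) f

negₚ : Poly → Poly
negₚ = scalarₚ (ℤ.- ℤ.1ℤ)

_-ₚ_ : Poly → Poly → Poly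
f -ₚ g = f +ₚ negₚ g

shiftₚ : Poly → Poly
shiftₚ f = ℤ.0ℤ ∷ f

_*ₚ_ : Poly → Poly → Poly
[] *ₚ g = []
(a ∷ f) *ₚ g = scalarₚ a g +ₚ shiftₚ (f *ₚ g)

coeff : Poly → ℕ → ℤ
coeff [] k = ℤ.0ℤ
coeff (a ∷ f) zero = a
coeff (a ∷ f) (suc k) = coeff f k

_≡ₚ_[mod_] : Poly → Poly → ℕ → Set
f ≡ₚ g [mod p ] = ∀ k → (+ p) ℤD.∣ (coeff f k ℤ.- coeff g k)

T : ℕ → Poly
T zero = ℤ.1ℤ ∷ []
T (suc zero) = ℤ.0ℤ ∷ ℤ.1ℤ ∷ []
T (suc (suc n)) = shiftₚ (scalarₚ (+ 2) (T (suc n))) -ₚ T n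

linProd : List ℕ → Poly
linProd [] = ℤ.1ℤ ∷ []
linProd (a ∷ A) = ((- (+ a)) ∷ ℤ.1ℤ ∷ []) *ₚ linProd A

-- A (entries in F_p) is the multiset of roots, with multiplicity, of
-- f over F_p and f splits completely over F_p:  f = u · ∏_{a∈A} (x - a)
-- in F_p[x] for some unit u ∈ F_p^×.
RootMultisetSplit : ℕ → Poly → List ℕ → Set
RootMultisetSplit p f A =
  All (_< p) A ×
  Σ ℤ (λ u → ¬ ((+ p) ℤD.∣ u) × (f ≡ₚ scalarₚ u (linProd A) [mod p ]))

-- (i) Write T n − c = u · ∏_{a ∈ A} (x − a) over 𝔽_p. The leading coefficient 2ⁿ⁻¹ of T n is a
-- unit since p > 2, so |A| = n; the factorisations for c₁ and c₂ then share the unit u and all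
-- non-constant coefficients, so the elementary symmetric functions e₁ … eₙ₋₁ of A and B agree,
-- and by Newton's identities so do the power sums p₁ … pₙ₋₁. T n takes the value cᵢ on the roots
-- of T n − cᵢ, which makes A and B disjoint; for even n the polynomial T n is even, and unique
-- factorisation in 𝔽_p[x] turns this into A = −A.
-- (ii) For 1 ≤ k < n the k-th power sum of sA is s^k · Σ_{i<n} (a^k)^i, and (a^k − 1) times this
-- geometric sum is (aⁿ)^k − 1 = 0 with a^k ≠ 1. From a^{n/2} = −1 we get A = −A and so sA = −sA,
-- and sA meets A only if s ∈ A. As p − 1 ∈ A, fewer than n of 0 … p − 2 lie in A, which leaves at
-- least (p − 1)/n admissible s, the first of them 0.

module Submission where

open import Defs
open import Data.Nat as ℕ using (ℕ; zero; suc; _∸_; z≤n; s≤s)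
import Data.Nat.Properties as ℕP
import Data.Nat.Divisibility as ℕD
import Data.Nat.DivMod as ℕDM
open import Data.Nat.Primality using (Prime; euclidsLemma; prime⇒nonTrivial)
open import Data.Integer as ℤ using (ℤ; +_; -_; _-_; 0ℤ; 1ℤ)
import Data.Integer.Properties as ℤP
import Data.Integer.Divisibility as ℤDᵤ
open import Data.Integer.Divisibility.Signed as ℤD using (divides)
open import Data.Integer.Tactic.RingSolver using (solve-∀)
open import Data.Empty using (⊥; ⊥-elim)
open import Data.Sum using (_⊎_; inj₁; inj₂; [_,_]′)
open import Data.List using (List; []; _∷_; map; length; _++_; applyUpTo; upTo; filter; take)
open import Data.Nat.ListAction using (sum)
open import Data.List.Relation.Unary.All as All using (All; []; _∷_)
import Data.List.Relation.Unary.All.Properties as AllP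
open import Data.List.Relation.Unary.Any as Any using (here; there)
open import Data.List.Membership.Propositional using (_∈_)
open import Data.List.Membership.Propositional.Properties using (∈-map⁺; ∈-map⁻; ∈-∃++; ∈-upTo⁺; ∈-upTo⁻; ∈-++⁻; ∈-++⁺ˡ; ∈-++⁺ʳ; ∈-filter⁺; ∈-filter⁻)
open import Data.List.Membership.DecPropositional ℕP._≟_ using (_∈?_)
open import Data.List.Properties using (length-map; length-upTo; map-upTo; map-cong; map-∘; map-cong-local; length-++-sucʳ; length-take; filter-accept; filter-notAll)
open import Data.List.Relation.Unary.Unique.Propositional using (Unique; []; _∷_)
import Data.List.Relation.Unary.Unique.Propositional.Properties as UniqueP
open import Data.List.Relation.Binary.Pointwise using (Pointwise; []; _∷_)
open import Data.List.Relation.Binary.Permutation.Propositional.Properties using (shift; map⁺; All-resp-↭; ++-comm)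
open import Data.Product using (Σ; _×_; _,_; proj₁; proj₂; ∃-syntax)
open import Data.List.Relation.Binary.Permutation.Propositional as ↭ using (_↭_)
open import Function using (_∘_)
open import Data.Nat.Induction using (<-rec)
open import Relation.Nullary using (¬_; yes; no; ¬?)
open import Relation.Unary using (Decidable)
open import Relation.Unary.Properties using (∁?)
open import Relation.Binary.Bundles using (Setoid)
open import Relation.Binary.Structures using (IsEquivalence)
open import Relation.Binary.Definitions using (tri<; tri≈; tri>)
open import Relation.Binary.PropositionalEquality

module IntegerPolynomials where

  open import Data.Integer using (_+_; _*_; _^_)

  linear : ℤ → Poly
  linear r = - r ∷ 1ℤ ∷ []

  rootProd : List ℤ → Poly
  rootProd []      = 1ℤ ∷ []
  rootProd (r ∷ R) = linear r *ₚ rootProd R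

  linProd≡rootProd : ∀ A → linProd A ≡ rootProd (map +_ A)
  linProd≡rootProd []      = refl
  linProd≡rootProd (a ∷ A) = cong (linear (+ a) *ₚ_) (linProd≡rootProd A)

  coeff-+ₚ : ∀ f g k → coeff (f +ₚ g) k ≡ coeff f k + coeff g k
  coeff-+ₚ []      g       k       = sym (ℤP.+-identityˡ _)
  coeff-+ₚ (a ∷ f) []      k       = sym (ℤP.+-identityʳ _)
  coeff-+ₚ (a ∷ f) (b ∷ g) zero    = refl
  coeff-+ₚ (a ∷ f) (b ∷ g) (suc k) = coeff-+ₚ f g k

  coeff-scalarₚ : ∀ c f k → coeff (scalarₚ c f) k ≡ c * coeff f k
  coeff-scalarₚ c []      k       = sym (ℤP.*-zeroʳ c)
  coeff-scalarₚ c (a ∷ f) zero    = refl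
  coeff-scalarₚ c (a ∷ f) (suc k) = coeff-scalarₚ c f k

  coeff--ₚ : ∀ f g k → coeff (f -ₚ g) k ≡ coeff f k - coeff g k
  coeff--ₚ f g k = trans (coeff-+ₚ f (negₚ g) k)
    (cong (λ t → coeff f k + t) (trans (coeff-scalarₚ (- 1ℤ) g k) (ℤP.-1*i≡-i _)))

  coeff--ₚ-const : ∀ f c k → coeff (f -ₚ (c ∷ [])) (suc k) ≡ coeff f (suc k)
  coeff--ₚ-const f c k = trans (coeff--ₚ f (c ∷ []) (suc k)) (ℤP.+-identityʳ _)

  coeff-beyond-length : ∀ f k → length f ℕ.≤ k → coeff f k ≡ 0ℤ
  coeff-beyond-length []      k       _         = refl
  coeff-beyond-length (a ∷ f) (suc k) (s≤s f≤k) = coeff-beyond-length f k f≤k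

  mulLinear : ℤ → (ℕ → ℤ) → ℕ → ℤ
  mulLinear r c zero    = - r * c zero
  mulLinear r c (suc k) = - r * c (suc k) + c k

  coeff-linear-*ₚ : ∀ r g k → coeff (linear r *ₚ g) k ≡ mulLinear r (coeff g) k
  coeff-linear-*ₚ r g zero    = begin
    coeff (scalarₚ (- r) g +ₚ shiftₚ ((1ℤ ∷ []) *ₚ g)) 0  ≡⟨ coeff-+ₚ (scalarₚ (- r) g) _ 0 ⟩
    coeff (scalarₚ (- r) g) 0 + 0ℤ                       ≡⟨ ℤP.+-identityʳ _ ⟩
    coeff (scalarₚ (- r) g) 0                            ≡⟨ coeff-scalarₚ (- r) g 0 ⟩
    - r * coeff g 0                                      ∎
    where open ≡-Reasoning
  coeff-linear-*ₚ r g (suc k) = begin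
    coeff (scalarₚ (- r) g +ₚ shiftₚ ((1ℤ ∷ []) *ₚ g)) (suc k)        ≡⟨ coeff-+ₚ (scalarₚ (- r) g) _ (suc k) ⟩
    coeff (scalarₚ (- r) g) (suc k) + coeff (scalarₚ 1ℤ g +ₚ (0ℤ ∷ [])) k
      ≡⟨ cong₂ _+_ (coeff-scalarₚ (- r) g (suc k)) (coeff-+ₚ (scalarₚ 1ℤ g) (0ℤ ∷ []) k) ⟩
    - r * coeff g (suc k) + (coeff (scalarₚ 1ℤ g) k + coeff (0ℤ ∷ []) k)
      ≡⟨ cong (λ t → - r * coeff g (suc k) + t) (cong₂ _+_ (coeff-scalarₚ 1ℤ g k) (coeff-singleton-zero k)) ⟩
    - r * coeff g (suc k) + (1ℤ * coeff g k + 0ℤ)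
      ≡⟨ cong (λ t → - r * coeff g (suc k) + t) (trans (ℤP.+-identityʳ _) (ℤP.*-identityˡ _)) ⟩
    - r * coeff g (suc k) + coeff g k                               ∎
    where
    open ≡-Reasoning
    coeff-singleton-zero : ∀ k → coeff (0ℤ ∷ []) k ≡ 0ℤ
    coeff-singleton-zero zero    = refl
    coeff-singleton-zero (suc k) = refl

  eval : Poly → ℤ → ℤ
  eval []      x = 0ℤ
  eval (c ∷ f) x = c + x * eval f x

  eval-+ₚ : ∀ f g x → eval (f +ₚ g) x ≡ eval f x + eval g x
  eval-+ₚ []      g       x = sym (ℤP.+-identityˡ _)
  eval-+ₚ (a ∷ f) []      x = sym (ℤP.+-identityʳ _)
  eval-+ₚ (a ∷ f) (b ∷ g) x = trans (cong (λ t → a + b + x * t) (eval-+ₚ f g x)) (lemma a b x (eval f x) (eval g x))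
    where lemma : ∀ a b x u v → a + b + x * (u + v) ≡ a + x * u + (b + x * v)
          lemma = solve-∀

  eval-scalarₚ : ∀ c f x → eval (scalarₚ c f) x ≡ c * eval f x
  eval-scalarₚ c []      x = sym (ℤP.*-zeroʳ c)
  eval-scalarₚ c (a ∷ f) x = trans (cong (λ t → c * a + x * t) (eval-scalarₚ c f x)) (lemma c a x (eval f x))
    where lemma : ∀ c a x u → c * a + x * (c * u) ≡ c * (a + x * u)
          lemma = solve-∀

  eval--ₚ : ∀ f g x → eval (f -ₚ g) x ≡ eval f x - eval g x
  eval--ₚ f g x = trans (eval-+ₚ f (negₚ g) x)
    (cong (λ t → eval f x + t) (trans (eval-scalarₚ (- 1ℤ) g x) (ℤP.-1*i≡-i _)))

  eval-linear-*ₚ : ∀ r g x → eval (linear r *ₚ g) x ≡ (x - r) * eval g x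
  eval-linear-*ₚ r g x = begin
    eval (scalarₚ (- r) g +ₚ shiftₚ (scalarₚ 1ℤ g +ₚ (0ℤ ∷ []))) x
      ≡⟨ eval-+ₚ (scalarₚ (- r) g) _ x ⟩
    eval (scalarₚ (- r) g) x + (0ℤ + x * eval (scalarₚ 1ℤ g +ₚ (0ℤ ∷ [])) x)
      ≡⟨ cong₂ (λ s t → s + (0ℤ + x * t)) (eval-scalarₚ (- r) g x) (eval-+ₚ (scalarₚ 1ℤ g) (0ℤ ∷ []) x) ⟩
    - r * eval g x + (0ℤ + x * (eval (scalarₚ 1ℤ g) x + (0ℤ + x * 0ℤ)))
      ≡⟨ cong (λ t → - r * eval g x + (0ℤ + x * (t + (0ℤ + x * 0ℤ)))) (eval-scalarₚ 1ℤ g x) ⟩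
    - r * eval g x + (0ℤ + x * (1ℤ * eval g x + (0ℤ + x * 0ℤ)))
      ≡⟨ lemma r x (eval g x) ⟩
    (x - r) * eval g x ∎
    where
    open ≡-Reasoning
    lemma : ∀ r x u → - r * u + (0ℤ + x * (1ℤ * u + (0ℤ + x * 0ℤ))) ≡ (x - r) * u
    lemma = solve-∀

  eval-rootProd-[] : ∀ x → eval (rootProd []) x ≡ 1ℤ
  eval-rootProd-[] x = trans (cong (λ t → 1ℤ + t) (ℤP.*-zeroʳ x)) (ℤP.+-identityʳ 1ℤ)

  eval-rootProd-∈ : ∀ {r R} → r ∈ R → eval (rootProd R) r ≡ 0ℤ
  eval-rootProd-∈ {r} {r ∷ R} (here refl) = begin
    eval (linear r *ₚ rootProd R) r   ≡⟨ eval-linear-*ₚ r (rootProd R) r ⟩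
    (r - r) * eval (rootProd R) r     ≡⟨ cong (_* eval (rootProd R) r) (ℤP.+-inverseʳ r) ⟩
    0ℤ                               ∎
    where open ≡-Reasoning
  eval-rootProd-∈ {r} {s ∷ R} (there r∈R) = begin
    eval (linear s *ₚ rootProd R) r   ≡⟨ eval-linear-*ₚ s (rootProd R) r ⟩
    (r - s) * eval (rootProd R) r     ≡⟨ cong ((r - s) *_) (eval-rootProd-∈ r∈R) ⟩
    (r - s) * 0ℤ                     ≡⟨ ℤP.*-zeroʳ (r - s) ⟩
    0ℤ                               ∎
    where open ≡-Reasoning

  -- elemSym j R = (-1)^j e_j(R), the coefficient of x^(|R| - j) in ∏_{r ∈ R} (x - r).
  elemSym : ℕ → List ℤ → ℤ
  elemSym zero    R       = 1ℤ
  elemSym (suc j) []      = 0ℤ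
  elemSym (suc j) (r ∷ R) = elemSym (suc j) R - r * elemSym j R

  elemSym-beyond : ∀ R j → length R ℕ.< j → elemSym j R ≡ 0ℤ
  elemSym-beyond []      (suc j) _           = refl
  elemSym-beyond (r ∷ R) (suc j) (s≤s |R|<j) = begin
    elemSym (suc j) R - r * elemSym j R ≡⟨ cong₂ (λ u v → u - r * v) (elemSym-beyond R (suc j) (ℕP.m<n⇒m<1+n |R|<j)) (elemSym-beyond R j |R|<j) ⟩
    0ℤ - r * 0ℤ                         ≡⟨ lemma r ⟩
    0ℤ                                  ∎
    where
    open ≡-Reasoning
    lemma : ∀ r → 0ℤ - r * 0ℤ ≡ 0ℤ
    lemma = solve-∀

  coeff-rootProd-beyond : ∀ R k → length R ℕ.< k → coeff (rootProd R) k ≡ 0ℤ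
  coeff-rootProd-beyond []      (suc k) _           = refl
  coeff-rootProd-beyond (r ∷ R) (suc k) (s≤s |R|<k) = begin
    coeff (linear r *ₚ rootProd R) (suc k)
      ≡⟨ coeff-linear-*ₚ r (rootProd R) (suc k) ⟩
    - r * coeff (rootProd R) (suc k) + coeff (rootProd R) k
      ≡⟨ cong₂ (λ u v → - r * u + v) (coeff-rootProd-beyond R (suc k) (ℕP.m<n⇒m<1+n |R|<k)) (coeff-rootProd-beyond R k |R|<k) ⟩
    - r * 0ℤ + 0ℤ
      ≡⟨ lemma r ⟩
    0ℤ ∎
    where
    open ≡-Reasoning
    lemma : ∀ r → - r * 0ℤ + 0ℤ ≡ 0ℤ
    lemma = solve-∀

  coeff-rootProd : ∀ R i j → i ℕ.+ j ≡ length R → coeff (rootProd R) i ≡ elemSym j R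
  coeff-rootProd []      zero    zero    _   = refl
  coeff-rootProd (r ∷ R) (suc i) zero    eq  = begin
    coeff (rootProd (r ∷ R)) (suc i)
      ≡⟨ coeff-linear-*ₚ r (rootProd R) (suc i) ⟩
    - r * coeff (rootProd R) (suc i) + coeff (rootProd R) i
      ≡⟨ cong₂ (λ u v → - r * u + v) (coeff-rootProd-beyond R (suc i) (s≤s (ℕP.≤-reflexive (sym i≡|R|))))
                                     (coeff-rootProd R i 0 (ℕP.suc-injective eq)) ⟩
    - r * 0ℤ + 1ℤ
      ≡⟨ lemma r ⟩
    1ℤ ∎
    where
    open ≡-Reasoning
    i≡|R| : i ≡ length R
    i≡|R| = trans (sym (ℕP.+-identityʳ i)) (ℕP.suc-injective eq)
    lemma : ∀ r → - r * 0ℤ + 1ℤ ≡ 1ℤ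
    lemma = solve-∀
  coeff-rootProd (r ∷ R) zero    (suc j) eq  = begin
    coeff (rootProd (r ∷ R)) 0
      ≡⟨ coeff-linear-*ₚ r (rootProd R) 0 ⟩
    - r * coeff (rootProd R) 0
      ≡⟨ cong (- r *_) (coeff-rootProd R 0 j (ℕP.suc-injective eq)) ⟩
    - r * elemSym j R
      ≡⟨ lemma r (elemSym j R) ⟩
    0ℤ - r * elemSym j R
      ≡⟨ cong (λ u → u - r * elemSym j R) (elemSym-beyond R (suc j) (s≤s (ℕP.≤-reflexive (sym (ℕP.suc-injective eq))))) ⟨
    elemSym (suc j) R - r * elemSym j R ∎
    where
    open ≡-Reasoning
    lemma : ∀ r e → - r * e ≡ 0ℤ - r * e
    lemma = solve-∀
  coeff-rootProd (r ∷ R) (suc i) (suc j) eq  = begin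
    coeff (rootProd (r ∷ R)) (suc i)
      ≡⟨ coeff-linear-*ₚ r (rootProd R) (suc i) ⟩
    - r * coeff (rootProd R) (suc i) + coeff (rootProd R) i
      ≡⟨ cong₂ (λ u v → - r * u + v) (coeff-rootProd R (suc i) j (trans (sym (ℕP.+-suc i j)) i+1+j≡|R|))
                                     (coeff-rootProd R i (suc j) i+1+j≡|R|) ⟩
    - r * elemSym j R + elemSym (suc j) R
      ≡⟨ lemma r (elemSym j R) (elemSym (suc j) R) ⟩
    elemSym (suc j) R - r * elemSym j R ∎
    where
    open ≡-Reasoning
    i+1+j≡|R| : i ℕ.+ suc j ≡ length R
    i+1+j≡|R| = ℕP.suc-injective eq
    lemma : ∀ r e e′ → - r * e + e′ ≡ e′ - r * e
    lemma = solve-∀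

  mulLinear-cong : ∀ r {c d} → (∀ k → c k ≡ d k) → ∀ k → mulLinear r c k ≡ mulLinear r d k
  mulLinear-cong r c≡d zero    = cong (- r *_) (c≡d zero)
  mulLinear-cong r c≡d (suc k) = cong₂ (λ u v → - r * u + v) (c≡d (suc k)) (c≡d k)

  mulLinear-comm : ∀ r s c k → mulLinear r (mulLinear s c) k ≡ mulLinear s (mulLinear r c) k
  mulLinear-comm r s c zero          = lemma r s (c 0)
    where lemma : ∀ r s x → - r * (- s * x) ≡ - s * (- r * x)
          lemma = solve-∀
  mulLinear-comm r s c (suc zero)    = lemma r s (c 0) (c 1)
    where lemma : ∀ r s x y → - r * (- s * y + x) + - s * x ≡ - s * (- r * y + x) + - r * x
          lemma = solve-∀
  mulLinear-comm r s c (suc (suc k)) = lemma r s (c k) (c (suc k)) (c (suc (suc k)))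
    where lemma : ∀ r s x y z → - r * (- s * z + y) + (- s * y + x) ≡ - s * (- r * z + y) + (- r * y + x)
          lemma = solve-∀

  coeff-rootProd-↭ : ∀ {R R′} → R ↭ R′ → ∀ k → coeff (rootProd R) k ≡ coeff (rootProd R′) k
  coeff-rootProd-↭ ↭.refl k = refl
  coeff-rootProd-↭ {r ∷ R} {r ∷ R′} (↭.prep r R↭R′) k = begin
    coeff (linear r *ₚ rootProd R) k        ≡⟨ coeff-linear-*ₚ r (rootProd R) k ⟩
    mulLinear r (coeff (rootProd R)) k      ≡⟨ mulLinear-cong r (coeff-rootProd-↭ R↭R′) k ⟩
    mulLinear r (coeff (rootProd R′)) k     ≡⟨ coeff-linear-*ₚ r (rootProd R′) k ⟨
    coeff (linear r *ₚ rootProd R′) k       ∎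
    where open ≡-Reasoning
  coeff-rootProd-↭ {r ∷ s ∷ R} {s ∷ r ∷ R′} (↭.swap r s R↭R′) k = begin
    coeff (linear r *ₚ (linear s *ₚ rootProd R)) k
      ≡⟨ coeff-linear-*ₚ r (linear s *ₚ rootProd R) k ⟩
    mulLinear r (coeff (linear s *ₚ rootProd R)) k
      ≡⟨ mulLinear-cong r (λ j → trans (coeff-linear-*ₚ s (rootProd R) j) (mulLinear-cong s (coeff-rootProd-↭ R↭R′) j)) k ⟩
    mulLinear r (mulLinear s (coeff (rootProd R′))) k
      ≡⟨ mulLinear-comm r s (coeff (rootProd R′)) k ⟩
    mulLinear s (mulLinear r (coeff (rootProd R′))) k
      ≡⟨ mulLinear-cong s (coeff-linear-*ₚ r (rootProd R′)) k ⟨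
    mulLinear s (coeff (linear r *ₚ rootProd R′)) k
      ≡⟨ coeff-linear-*ₚ s (linear r *ₚ rootProd R′) k ⟨
    coeff (linear s *ₚ (linear r *ₚ rootProd R′)) k ∎
    where open ≡-Reasoning
  coeff-rootProd-↭ (↭.trans R↭R′ R′↭R″) k = trans (coeff-rootProd-↭ R↭R′ k) (coeff-rootProd-↭ R′↭R″ k)

  coeff-rootProd-map-neg : ∀ R k → coeff (rootProd (map -_ R)) k ≡ (- 1ℤ) ^ (length R ℕ.+ k) * coeff (rootProd R) k
  coeff-rootProd-map-neg []      zero    = refl
  coeff-rootProd-map-neg []      (suc k) = sym (ℤP.*-zeroʳ ((- 1ℤ) ^ suc k))
  coeff-rootProd-map-neg (r ∷ R) zero    = begin
    coeff (rootProd (map -_ (r ∷ R))) 0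
      ≡⟨ coeff-linear-*ₚ (- r) (rootProd (map -_ R)) 0 ⟩
    - - r * coeff (rootProd (map -_ R)) 0
      ≡⟨ cong (- - r *_) (coeff-rootProd-map-neg R 0) ⟩
    - - r * ((- 1ℤ) ^ (length R ℕ.+ 0) * coeff (rootProd R) 0)
      ≡⟨ lemma r ((- 1ℤ) ^ (length R ℕ.+ 0)) (coeff (rootProd R) 0) ⟩
    (- 1ℤ * (- 1ℤ) ^ (length R ℕ.+ 0)) * (- r * coeff (rootProd R) 0)
      ≡⟨ cong ((- 1ℤ) ^ suc (length R ℕ.+ 0) *_) (coeff-linear-*ₚ r (rootProd R) 0) ⟨
    (- 1ℤ) ^ (length (r ∷ R) ℕ.+ 0) * coeff (rootProd (r ∷ R)) 0 ∎
    where
    open ≡-Reasoning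
    lemma : ∀ r s c → - - r * (s * c) ≡ (- 1ℤ * s) * (- r * c)
    lemma = solve-∀
  coeff-rootProd-map-neg (r ∷ R) (suc k) = begin
    coeff (rootProd (map -_ (r ∷ R))) (suc k)
      ≡⟨ coeff-linear-*ₚ (- r) (rootProd (map -_ R)) (suc k) ⟩
    - - r * coeff (rootProd (map -_ R)) (suc k) + coeff (rootProd (map -_ R)) k
      ≡⟨ cong₂ (λ u v → - - r * u + v) (coeff-rootProd-map-neg R (suc k)) (coeff-rootProd-map-neg R k) ⟩
    - - r * ((- 1ℤ) ^ (length R ℕ.+ suc k) * c₁) + s * c₀
      ≡⟨ cong (λ m → - - r * ((- 1ℤ) ^ m * c₁) + s * c₀) (ℕP.+-suc (length R) k) ⟩
    - - r * (- 1ℤ * s * c₁) + s * c₀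
      ≡⟨ lemma r s c₀ c₁ ⟩
    - 1ℤ * (- 1ℤ * s) * (- r * c₁ + c₀)
      ≡⟨ cong (λ m → (- 1ℤ) ^ suc m * (- r * c₁ + c₀)) (ℕP.+-suc (length R) k) ⟨
    (- 1ℤ) ^ (length (r ∷ R) ℕ.+ suc k) * (- r * c₁ + c₀)
      ≡⟨ cong ((- 1ℤ) ^ (length (r ∷ R) ℕ.+ suc k) *_) (coeff-linear-*ₚ r (rootProd R) (suc k)) ⟨
    (- 1ℤ) ^ (length (r ∷ R) ℕ.+ suc k) * coeff (rootProd (r ∷ R)) (suc k) ∎
    where
    open ≡-Reasoning
    s  = (- 1ℤ) ^ (length R ℕ.+ k)
    c₀ = coeff (rootProd R) k
    c₁ = coeff (rootProd R) (suc k)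
    lemma : ∀ r s c₀ c₁ → - - r * (- 1ℤ * s * c₁) + s * c₀ ≡ - 1ℤ * (- 1ℤ * s) * (- r * c₁ + c₀)
    lemma = solve-∀

  sumBelow : ℕ → (ℕ → ℤ) → ℤ
  sumBelow zero    f = 0ℤ
  sumBelow (suc k) f = f 0 + sumBelow k (f ∘ suc)

  sumBelow-cong : ∀ k {f g} → (∀ j → j ℕ.< k → f j ≡ g j) → sumBelow k f ≡ sumBelow k g
  sumBelow-cong zero    f≡g = refl
  sumBelow-cong (suc k) f≡g = cong₂ _+_ (f≡g 0 (s≤s z≤n)) (sumBelow-cong k (λ j j<k → f≡g (suc j) (s≤s j<k)))

  sumBelow-+ : ∀ k f g → sumBelow k (λ j → f j + g j) ≡ sumBelow k f + sumBelow k g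
  sumBelow-+ zero    f g = refl
  sumBelow-+ (suc k) f g = trans (cong (λ t → f 0 + g 0 + t) (sumBelow-+ k (f ∘ suc) (g ∘ suc))) (lemma (f 0) (g 0) _ _)
    where lemma : ∀ a b c d → a + b + (c + d) ≡ a + c + (b + d)
          lemma = solve-∀

  sumBelow-*ˡ : ∀ k c f → sumBelow k (λ j → c * f j) ≡ c * sumBelow k f
  sumBelow-*ˡ zero    c f = sym (ℤP.*-zeroʳ c)
  sumBelow-*ˡ (suc k) c f = trans (cong (λ t → c * f 0 + t) (sumBelow-*ˡ k c (f ∘ suc))) (sym (ℤP.*-distribˡ-+ c _ _))

  sumBelow-telescope : ∀ k (g : ℕ → ℤ) → sumBelow k (λ j → g (suc j) - g j) ≡ g k - g 0
  sumBelow-telescope zero    g = sym (ℤP.+-inverseʳ (g 0))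
  sumBelow-telescope (suc k) g = begin
    (g 1 - g 0) + sumBelow k (λ j → g (suc (suc j)) - g (suc j)) ≡⟨ cong (λ t → g 1 - g 0 + t) (sumBelow-telescope k (g ∘ suc)) ⟩
    (g 1 - g 0) + (g (suc k) - g 1)                             ≡⟨ lemma (g 0) (g 1) (g (suc k)) ⟩
    g (suc k) - g 0                                             ∎
    where
    open ≡-Reasoning
    lemma : ∀ a b c → b - a + (c - b) ≡ c - a
    lemma = solve-∀

  powerSum : ℕ → List ℤ → ℤ
  powerSum k []      = 0ℤ
  powerSum k (r ∷ R) = r ^ k + powerSum k R

  pos-^ : ∀ a k → + (a ℕ.^ k) ≡ (+ a) ^ k
  pos-^ a zero    = refl
  pos-^ a (suc k) = trans (ℤP.pos-* a (a ℕ.^ k)) (cong (+ a *_) (pos-^ a k))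

  pos-sum-^ : ∀ k A → + sum (map (ℕ._^ k) A) ≡ powerSum k (map +_ A)
  pos-sum-^ k []      = refl
  pos-sum-^ k (a ∷ A) = trans (ℤP.pos-+ (a ℕ.^ k) _) (cong₂ _+_ (pos-^ a k) (pos-sum-^ k A))

  ^-distribʳ-* : ∀ x y k → (x * y) ^ k ≡ x ^ k * y ^ k
  ^-distribʳ-* x y zero    = refl
  ^-distribʳ-* x y (suc k) = trans (cong (x * y *_) (^-distribʳ-* x y k)) (lemma x y (x ^ k) (y ^ k))
    where lemma : ∀ x y u v → x * y * (u * v) ≡ x * u * (y * v)
          lemma = solve-∀

  ^-comm : ∀ x i k → (x ^ i) ^ k ≡ (x ^ k) ^ i
  ^-comm x i k = trans (ℤP.^-*-assoc x i k) (trans (cong (x ^_) (ℕP.*-comm i k)) (sym (ℤP.^-*-assoc x k i)))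

  powerSum-applyUpTo : ∀ k (g : ℕ → ℤ) m → powerSum k (applyUpTo g m) ≡ sumBelow m (λ i → g i ^ k)
  powerSum-applyUpTo k g zero    = refl
  powerSum-applyUpTo k g (suc m) = cong (λ t → g 0 ^ k + t) (powerSum-applyUpTo k (g ∘ suc) m)

  geometric-sum : ∀ x m → (x - 1ℤ) * sumBelow m (x ^_) ≡ x ^ m - 1ℤ
  geometric-sum x zero    = ℤP.*-zeroʳ (x - 1ℤ)
  geometric-sum x (suc m) = begin
    (x - 1ℤ) * (1ℤ + sumBelow m (λ i → x * x ^ i)) ≡⟨ cong (λ t → (x - 1ℤ) * (1ℤ + t)) (sumBelow-*ˡ m x (x ^_)) ⟩
    (x - 1ℤ) * (1ℤ + x * sumBelow m (x ^_))        ≡⟨ lemma x (sumBelow m (x ^_)) ⟩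
    x * ((x - 1ℤ) * sumBelow m (x ^_)) + x - 1ℤ    ≡⟨ cong (λ t → x * t + x - 1ℤ) (geometric-sum x m) ⟩
    x * (x ^ m - 1ℤ) + x - 1ℤ                      ≡⟨ lemma′ x (x ^ m) ⟩
    x * x ^ m - 1ℤ                                 ∎
    where
    open ≡-Reasoning
    lemma : ∀ x s → (x - 1ℤ) * (1ℤ + x * s) ≡ x * ((x - 1ℤ) * s) + x - 1ℤ
    lemma = solve-∀
    lemma′ : ∀ x y → x * (y - 1ℤ) + x - 1ℤ ≡ x * y - 1ℤ
    lemma′ = solve-∀

  newtonSum : ℕ → List ℤ → ℤ
  newtonSum k R = sumBelow k (λ j → elemSym j R * powerSum (k ∸ j) R)

  newtonSum-∷ : ∀ k a A → newtonSum (suc k) (a ∷ A) ≡ newtonSum (suc k) A - a * newtonSum k A + a * elemSym k A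
  newtonSum-∷ k a A = begin
    1ℤ * (a ^ suc k + P (suc k)) + sumBelow k (λ j → (e (suc j) - a * e j) * (a ^ (k ∸ j) + P (k ∸ j)))
      ≡⟨ cong (λ t → 1ℤ * (a ^ suc k + P (suc k)) + t) (sumBelow-cong k termwise) ⟩
    1ℤ * (a ^ suc k + P (suc k)) + sumBelow k (λ j → (e (suc j) * P (k ∸ j) + - a * (e j * P (k ∸ j))) + (g (suc j) - g j))
      ≡⟨ cong (λ t → 1ℤ * (a ^ suc k + P (suc k)) + t) (trans (sumBelow-+ k _ _) (cong₂ _+_ (sumBelow-+ k _ _) (sumBelow-telescope k g))) ⟩
    1ℤ * (a ^ suc k + P (suc k)) + ((S + sumBelow k (λ j → - a * (e j * P (k ∸ j)))) + (g k - g 0))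
      ≡⟨ cong (λ t → 1ℤ * (a ^ suc k + P (suc k)) + ((S + t) + (g k - g 0))) (sumBelow-*ˡ k (- a) _) ⟩
    1ℤ * (a * a ^ k + P (suc k)) + ((S + - a * newtonSum k A) + (e k * a ^ suc (k ∸ k) - 1ℤ * (a * a ^ k)))
      ≡⟨ cong (λ m → 1ℤ * (a * a ^ k + P (suc k)) + ((S + - a * newtonSum k A) + (e k * (a * a ^ m) - 1ℤ * (a * a ^ k)))) (ℕP.n∸n≡0 k) ⟩
    1ℤ * (a * a ^ k + P (suc k)) + ((S + - a * newtonSum k A) + (e k * (a * 1ℤ) - 1ℤ * (a * a ^ k)))
      ≡⟨ lemma a (a ^ k) (P (suc k)) S (newtonSum k A) (e k) ⟩
    (1ℤ * P (suc k) + S) - a * newtonSum k A + a * e k ∎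
    where
    open ≡-Reasoning
    e = λ j → elemSym j A
    P = λ m → powerSum m A
    S = sumBelow k (λ j → e (suc j) * P (k ∸ j))
    g : ℕ → ℤ
    g j = e j * a ^ suc (k ∸ j)
    termwise : ∀ j → j ℕ.< k →
      (e (suc j) - a * e j) * (a ^ (k ∸ j) + P (k ∸ j)) ≡ (e (suc j) * P (k ∸ j) + - a * (e j * P (k ∸ j))) + (g (suc j) - g j)
    termwise j j<k = begin
      (e (suc j) - a * e j) * (a ^ (k ∸ j) + P (k ∸ j))
        ≡⟨ distribute a (a ^ (k ∸ j)) (P (k ∸ j)) (e (suc j)) (e j) ⟩
      (e (suc j) * P (k ∸ j) + - a * (e j * P (k ∸ j))) + (e (suc j) * a ^ (k ∸ j) - g j)
        ≡⟨ cong (λ m → (e (suc j) * P (k ∸ j) + - a * (e j * P (k ∸ j))) + (e (suc j) * a ^ m - g j)) (ℕP.+-∸-assoc 1 j<k) ⟩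
      (e (suc j) * P (k ∸ j) + - a * (e j * P (k ∸ j))) + (g (suc j) - g j) ∎
      where
      distribute : ∀ a u q e′ e → (e′ - a * e) * (u + q) ≡ (e′ * q + - a * (e * q)) + (e′ * u - e * (a * u))
      distribute = solve-∀
    lemma : ∀ a aᵏ q s c eₖ →
      1ℤ * (a * aᵏ + q) + ((s + - a * c) + (eₖ * (a * 1ℤ) - 1ℤ * (a * aᵏ))) ≡ (1ℤ * q + s) - a * c + a * eₖ
    lemma = solve-∀

  sumBelow-zero : ∀ k → sumBelow k (λ _ → 0ℤ) ≡ 0ℤ
  sumBelow-zero zero    = refl
  sumBelow-zero (suc k) = trans (ℤP.+-identityˡ _) (sumBelow-zero k)

  newton-identity : ∀ k R → newtonSum k R + + k * elemSym k R ≡ 0ℤ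
  newton-identity k       []      = cong₂ _+_ (trans (sumBelow-cong k (λ j _ → ℤP.*-zeroʳ (elemSym j []))) (sumBelow-zero k)) (last k)
    where
    last : ∀ k → + k * elemSym k [] ≡ 0ℤ
    last zero    = refl
    last (suc k) = ℤP.*-zeroʳ (+ suc k)
  newton-identity zero    (a ∷ A) = refl
  newton-identity (suc k) (a ∷ A) = begin
    newtonSum (suc k) (a ∷ A) + + suc k * (elemSym (suc k) A - a * elemSym k A)
      ≡⟨ cong (λ t → t + + suc k * (elemSym (suc k) A - a * elemSym k A)) (newtonSum-∷ k a A) ⟩
    newtonSum (suc k) A - a * newtonSum k A + a * elemSym k A + + suc k * (elemSym (suc k) A - a * elemSym k A)
      ≡⟨ cong (λ t → newtonSum (suc k) A - a * newtonSum k A + a * elemSym k A + t * (elemSym (suc k) A - a * elemSym k A)) (ℤP.pos-+ 1 k) ⟩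
    newtonSum (suc k) A - a * newtonSum k A + a * elemSym k A + (1ℤ + + k) * (elemSym (suc k) A - a * elemSym k A)
      ≡⟨ lemma a (newtonSum (suc k) A) (newtonSum k A) (elemSym (suc k) A) (elemSym k A) (+ k) ⟩
    (newtonSum (suc k) A + (1ℤ + + k) * elemSym (suc k) A) - a * (newtonSum k A + + k * elemSym k A)
      ≡⟨ cong₂ (λ u v → u - a * v) first-vanishes (newton-identity k A) ⟩
    0ℤ - a * 0ℤ
      ≡⟨ vanish a ⟩
    0ℤ ∎
    where
    open ≡-Reasoning
    lemma : ∀ a n′ n e′ e k → n′ - a * n + a * e + (1ℤ + k) * (e′ - a * e) ≡ (n′ + (1ℤ + k) * e′) - a * (n + k * e)
    lemma = solve-∀
    vanish : ∀ a → 0ℤ - a * 0ℤ ≡ 0ℤ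
    vanish = solve-∀
    first-vanishes : newtonSum (suc k) A + (1ℤ + + k) * elemSym (suc k) A ≡ 0ℤ
    first-vanishes = trans (cong (λ t → newtonSum (suc k) A + t * elemSym (suc k) A) (sym (ℤP.pos-+ 1 k)))
                           (newton-identity (suc k) A)

  powerSum-newton : ∀ k R → powerSum (suc k) R ≡ - (+ suc k * elemSym (suc k) R) - sumBelow k (λ j → elemSym (suc j) R * powerSum (k ∸ j) R)
  powerSum-newton k R = solve-for-p (powerSum (suc k) R) _ _ (newton-identity (suc k) R)
    where
    solve-for-p : ∀ q s t → 1ℤ * q + s + t ≡ 0ℤ → q ≡ - t - s
    solve-for-p q s t eq = begin
      q                        ≡⟨ lemma q s t ⟩
      (1ℤ * q + s + t) - t - s ≡⟨ cong (λ z → z - t - s) eq ⟩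
      0ℤ - t - s               ≡⟨ cong (_- s) (ℤP.+-identityˡ (- t)) ⟩
      - t - s                  ∎
      where
      open ≡-Reasoning
      lemma : ∀ q s t → q ≡ (1ℤ * q + s + t) - t - s
      lemma = solve-∀

  coeff-T-suc-suc : ∀ n k → coeff (T (suc (suc n))) (suc k) ≡ + 2 * coeff (T (suc n)) k - coeff (T n) (suc k)
  coeff-T-suc-suc n k = trans (coeff--ₚ (shiftₚ (scalarₚ (+ 2) (T (suc n)))) (T n) (suc k))
    (cong (_- coeff (T n) (suc k)) (coeff-scalarₚ (+ 2) (T (suc n)) k))

  coeff-T-beyond : ∀ n k → n ℕ.< k → coeff (T n) k ≡ 0ℤ
  coeff-T-beyond zero          (suc k)       _         = refl
  coeff-T-beyond (suc zero)    (suc zero)    (s≤s ())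
  coeff-T-beyond (suc zero)    (suc (suc k)) _         = refl
  coeff-T-beyond (suc (suc n)) (suc k)       (s≤s n<k) = begin
    coeff (T (suc (suc n))) (suc k)
      ≡⟨ coeff-T-suc-suc n k ⟩
    + 2 * coeff (T (suc n)) k - coeff (T n) (suc k)
      ≡⟨ cong₂ (λ u v → + 2 * u - v) (coeff-T-beyond (suc n) k n<k) (coeff-T-beyond n (suc k) (ℕP.<-trans (ℕP.n<1+n n) (ℕP.m<n⇒m<1+n n<k))) ⟩
    + 2 * 0ℤ - 0ℤ
      ≡⟨⟩
    0ℤ ∎
    where open ≡-Reasoning

  coeff-T-leading : ∀ n → coeff (T (suc n)) (suc n) ≡ (+ 2) ^ n
  coeff-T-leading zero    = refl
  coeff-T-leading (suc n) = begin
    coeff (T (suc (suc n))) (suc (suc n))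
      ≡⟨ coeff-T-suc-suc n (suc n) ⟩
    + 2 * coeff (T (suc n)) (suc n) - coeff (T n) (suc (suc n))
      ≡⟨ cong₂ (λ u v → + 2 * u - v) (coeff-T-leading n) (coeff-T-beyond n (suc (suc n)) (ℕP.<-trans (ℕP.n<1+n n) (ℕP.n<1+n (suc n)))) ⟩
    + 2 * (+ 2) ^ n - 0ℤ
      ≡⟨ ℤP.+-identityʳ _ ⟩
    (+ 2) ^ suc n ∎
    where open ≡-Reasoning

  coeff-T-parity : ∀ n k → coeff (T n) k ≡ (- 1ℤ) ^ (n ℕ.+ k) * coeff (T n) k
  coeff-T-parity zero          zero          = refl
  coeff-T-parity zero          (suc k)       = sym (ℤP.*-zeroʳ ((- 1ℤ) ^ suc k))
  coeff-T-parity (suc zero)    zero          = sym (ℤP.*-zeroʳ (- 1ℤ))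
  coeff-T-parity (suc zero)    (suc zero)    = refl
  coeff-T-parity (suc zero)    (suc (suc k)) = sym (ℤP.*-zeroʳ ((- 1ℤ) ^ (3 ℕ.+ k)))
  coeff-T-parity (suc (suc n)) zero          = begin
    coeff (T (suc (suc n))) 0                               ≡⟨ coeff--ₚ (shiftₚ (scalarₚ (+ 2) (T (suc n)))) (T n) 0 ⟩
    0ℤ - coeff (T n) 0                                      ≡⟨ cong (λ t → 0ℤ - t) (coeff-T-parity n 0) ⟩
    0ℤ - s * coeff (T n) 0                                  ≡⟨ lemma s (coeff (T n) 0) ⟩
    - 1ℤ * (- 1ℤ * s) * (0ℤ - coeff (T n) 0)                ≡⟨ cong (λ t → - 1ℤ * (- 1ℤ * s) * t) (coeff--ₚ (shiftₚ (scalarₚ (+ 2) (T (suc n)))) (T n) 0) ⟨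
    (- 1ℤ) ^ (suc (suc n) ℕ.+ 0) * coeff (T (suc (suc n))) 0 ∎
    where
    open ≡-Reasoning
    s = (- 1ℤ) ^ (n ℕ.+ 0)
    lemma : ∀ s c → 0ℤ - s * c ≡ - 1ℤ * (- 1ℤ * s) * (0ℤ - c)
    lemma = solve-∀
  coeff-T-parity (suc (suc n)) (suc k)       = begin
    coeff (T (suc (suc n))) (suc k)
      ≡⟨ coeff-T-suc-suc n k ⟩
    + 2 * a - b
      ≡⟨ cong₂ (λ u v → + 2 * u - v) (trans (coeff-T-parity (suc n) k) (cong (λ m → (- 1ℤ) ^ m * a) (sym (ℕP.+-suc n k)))) (coeff-T-parity n (suc k)) ⟩
    + 2 * (s * a) - s * b
      ≡⟨ lemma s a b ⟩
    - 1ℤ * (- 1ℤ * s) * (+ 2 * a - b)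
      ≡⟨ cong (λ t → - 1ℤ * (- 1ℤ * s) * t) (coeff-T-suc-suc n k) ⟨
    (- 1ℤ) ^ (suc (suc n) ℕ.+ suc k) * coeff (T (suc (suc n))) (suc k) ∎
    where
    open ≡-Reasoning
    a = coeff (T (suc n)) k
    b = coeff (T n) (suc k)
    s = (- 1ℤ) ^ (n ℕ.+ suc k)
    lemma : ∀ s a b → + 2 * (s * a) - s * b ≡ - 1ℤ * (- 1ℤ * s) * (+ 2 * a - b)
    lemma = solve-∀

  -1^[q*2]≡1 : ∀ q → (- 1ℤ) ^ (q ℕ.* 2) ≡ 1ℤ
  -1^[q*2]≡1 q = trans (cong ((- 1ℤ) ^_) (ℕP.*-comm q 2)) (trans (sym (ℤP.^-*-assoc (- 1ℤ) 2 q)) (ℤP.^-zeroˡ q))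

  coeff-T-const-leading : ∀ n c → 1 ℕ.≤ n → coeff (T n -ₚ (c ∷ [])) n ≡ (+ 2) ^ ℕ.pred n
  coeff-T-const-leading (suc n) c _ = trans (coeff--ₚ-const (T (suc n)) c n) (coeff-T-leading n)

  coeff-T-const-beyond : ∀ n c k → n ℕ.< k → coeff (T n -ₚ (c ∷ [])) k ≡ 0ℤ
  coeff-T-const-beyond n c (suc k) n<k = trans (coeff--ₚ-const (T n) c k) (coeff-T-beyond n (suc k) n<k)

  coeff-T-const-even : ∀ q c k → coeff (T (q ℕ.* 2) -ₚ (c ∷ [])) k ≡ (- 1ℤ) ^ k * coeff (T (q ℕ.* 2) -ₚ (c ∷ [])) k
  coeff-T-const-even q c zero    = sym (ℤP.*-identityˡ (coeff (T (q ℕ.* 2) -ₚ (c ∷ [])) 0))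
  coeff-T-const-even q c (suc k) = begin
    coeff (T n -ₚ (c ∷ [])) (suc k)                    ≡⟨ coeff--ₚ-const (T n) c k ⟩
    coeff (T n) (suc k)                                ≡⟨ coeff-T-parity n (suc k) ⟩
    (- 1ℤ) ^ (n ℕ.+ suc k) * coeff (T n) (suc k)       ≡⟨ cong (_* coeff (T n) (suc k)) (ℤP.^-distribˡ-+-* (- 1ℤ) n (suc k)) ⟩
    (- 1ℤ) ^ n * (- 1ℤ) ^ suc k * coeff (T n) (suc k)  ≡⟨ cong (λ t → t * (- 1ℤ) ^ suc k * coeff (T n) (suc k)) (-1^[q*2]≡1 q) ⟩
    1ℤ * (- 1ℤ) ^ suc k * coeff (T n) (suc k)          ≡⟨ cong (_* coeff (T n) (suc k)) (ℤP.*-identityˡ ((- 1ℤ) ^ suc k)) ⟩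
    (- 1ℤ) ^ suc k * coeff (T n) (suc k)               ≡⟨ cong ((- 1ℤ) ^ suc k *_) (coeff--ₚ-const (T n) c k) ⟨
    (- 1ℤ) ^ suc k * coeff (T n -ₚ (c ∷ [])) (suc k)   ∎
    where
    open ≡-Reasoning
    n = q ℕ.* 2

open IntegerPolynomials

mod≡% : ∀ m n .⦃ _ : ℕ.NonZero n ⦄ → m mod n ≡ m ℕDM.% n
mod≡% m (suc n) = refl

module Congruence (p : ℕ) where

  open import Data.Integer using (_+_; _*_; _^_)

  infix 4 _≈_
  record _≈_ (x y : ℤ) : Set where
    constructor mk
    field divides-difference : + p ℤD.∣ x - y

  ≈⇒∣ : ∀ {x} → x ≈ 0ℤ → + p ℤD.∣ x
  ≈⇒∣ {x} (mk d) = subst (+ p ℤD.∣_) (ℤP.+-identityʳ x) d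

  ∣⇒≈ : ∀ {x} → + p ℤD.∣ x → x ≈ 0ℤ
  ∣⇒≈ {x} d = mk (subst (+ p ℤD.∣_) (sym (ℤP.+-identityʳ x)) d)

  private
    via : ∀ {x y z} → z ≡ x - y → + p ℤD.∣ z → x ≈ y
    via refl d = mk d

  ≈-reflexive : ∀ {x y} → x ≡ y → x ≈ y
  ≈-reflexive {x} refl = via (sym (ℤP.+-inverseʳ x)) (divides 0ℤ (sym (ℤP.*-zeroˡ (+ p))))

  ≈-refl : ∀ {x} → x ≈ x
  ≈-refl = ≈-reflexive refl

  ≈-sym : ∀ {x y} → x ≈ y → y ≈ x
  ≈-sym {x} {y} (mk d) = via (lemma x y) (ℤD.∣m⇒∣-m d)
    where lemma : ∀ x y → - (x - y) ≡ y - x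
          lemma = solve-∀

  ≈-trans : ∀ {x y z} → x ≈ y → y ≈ z → x ≈ z
  ≈-trans {x} {y} {z} (mk d) (mk e) = via (lemma x y z) (ℤD.∣m∣n⇒∣m+n d e)
    where lemma : ∀ x y z → (x - y) + (y - z) ≡ x - z
          lemma = solve-∀

  ≈-isEquivalence : IsEquivalence _≈_
  ≈-isEquivalence = record { refl = ≈-refl ; sym = ≈-sym ; trans = ≈-trans }

  ≈-setoid : Setoid _ _
  ≈-setoid = record { isEquivalence = ≈-isEquivalence }

  +-cong : ∀ {x y u v} → x ≈ y → u ≈ v → x + u ≈ y + v
  +-cong {x} {y} {u} {v} (mk d) (mk e) = via (lemma x y u v) (ℤD.∣m∣n⇒∣m+n d e)
    where lemma : ∀ x y u v → (x - y) + (u - v) ≡ (x + u) - (y + v)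
          lemma = solve-∀

  *-cong : ∀ {x y u v} → x ≈ y → u ≈ v → x * u ≈ y * v
  *-cong {x} {y} {u} {v} (mk d) (mk e) =
    via (lemma x y u v) (ℤD.∣m∣n⇒∣m+n (ℤD.∣m⇒∣m*n u d) (ℤD.∣n⇒∣m*n y e))
    where lemma : ∀ x y u v → (x - y) * u + y * (u - v) ≡ x * u - y * v
          lemma = solve-∀

  -‿cong : ∀ {x y} → x ≈ y → - x ≈ - y
  -‿cong {x} {y} (mk d) = via (lemma x y) (ℤD.∣m⇒∣-m d)
    where lemma : ∀ x y → - (x - y) ≡ (- x) - (- y)
          lemma = solve-∀

  *-congˡ : ∀ {x y} c → x ≈ y → c * x ≈ c * y
  *-congˡ c = *-cong (≈-refl {c})

  *-congʳ : ∀ {x y} c → x ≈ y → x * c ≈ y * c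
  *-congʳ c e = *-cong e (≈-refl {c})

  ^-cong : ∀ {x y} k → x ≈ y → x ^ k ≈ y ^ k
  ^-cong zero    e = ≈-refl
  ^-cong (suc k) e = *-cong e (^-cong k e)

  private
    0+x*0≡0 : ∀ x → 0ℤ + x * 0ℤ ≡ 0ℤ
    0+x*0≡0 = solve-∀

  ≈⇒-≈0 : ∀ {x y} → x ≈ y → x - y ≈ 0ℤ
  ≈⇒-≈0 (mk d) = ∣⇒≈ d

  -≈0⇒≈ : ∀ {x y} → x - y ≈ 0ℤ → x ≈ y
  -≈0⇒≈ e = mk (≈⇒∣ e)

  ≈0⇒∣ᵤ : ∀ {x} → x ≈ 0ℤ → + p ℤDᵤ.∣ x
  ≈0⇒∣ᵤ = ℤD.∣⇒∣ᵤ ∘ ≈⇒∣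

  module ≈-Reasoning where
    open import Relation.Binary.Reasoning.Setoid ≈-setoid public

  private
    distinct-residues : ∀ {a b} → a ℕ.< p → b ℕ.< a → ¬ (+ a ≈ + b)
    distinct-residues {a} {b} a<p b<a (mk d) =
      ℕP.<⇒≱ (ℕP.≤-<-trans (ℕP.m∸n≤m a b) a<p) (ℕD.∣⇒≤ ⦃ ℕ.>-nonZero (ℕP.m<n⇒0<n∸m b<a) ⦄ p∣a∸b)
      where
      p∣a∸b : p ℕD.∣ a ∸ b
      p∣a∸b = ℤD.∣⇒∣ᵤ (subst (+ p ℤD.∣_) (trans (ℤP.m-n≡m⊖n a b) (ℤP.⊖-≥ (ℕP.<⇒≤ b<a))) d)

  residue-injective : ∀ {a b} → a ℕ.< p → b ℕ.< p → + a ≈ + b → a ≡ b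
  residue-injective {a} {b} a<p b<p a≈b with ℕP.<-cmp a b
  ... | tri≈ _ a≡b _ = a≡b
  ... | tri< a<b _ _ = ⊥-elim (distinct-residues b<p a<b (≈-sym a≈b))
  ... | tri> _ _ b<a = ⊥-elim (distinct-residues a<p b<a a≈b)

  negp-≈ : ∀ {a} → a ℕ.≤ p → + negp p a ≈ - + a
  negp-≈ {zero}  _   = ≈-refl
  negp-≈ {suc a} a≤p = via eq (ℤD.∣-refl {+ p})
    where
    eq : + p ≡ + (p ∸ suc a) - - + suc a
    eq = begin
      + p                                   ≡⟨ lemma (+ p) (+ suc a) ⟩
      + p - + suc a - - + suc a             ≡⟨ cong (_- - + suc a) (ℤP.m-n≡m⊖n p (suc a)) ⟩
      (p ℤ.⊖ suc a) - - + suc a             ≡⟨ cong (_- - + suc a) (ℤP.⊖-≥ a≤p) ⟩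
      + (p ∸ suc a) - - + suc a             ∎
      where
      open ≡-Reasoning
      lemma : ∀ x y → x ≡ x - y - - y
      lemma = solve-∀

  negp-pointwise : ∀ {A} → All (ℕ._< p) A → Pointwise _≈_ (map +_ (map (negp p) A)) (map -_ (map +_ A))
  negp-pointwise []          = []
  negp-pointwise (a<p ∷ A<p) = negp-≈ (ℕP.<⇒≤ a<p) ∷ negp-pointwise A<p

  module _ ⦃ _ : ℕ.NonZero p ⦄ where

    mod-≈ : ∀ x → + (x mod p) ≈ + x
    mod-≈ x = via eq (ℤD.∣m⇒∣-m (ℤD.∣n⇒∣m*n (+ (x ℕDM./ p)) (ℤD.∣-refl {+ p})))
      where
      r = x ℕDM.% p
      q = x ℕDM./ p
      lemma : ∀ r q p → - (q * p) ≡ r - (r + q * p)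
      lemma = solve-∀
      eq : - (+ q * + p) ≡ + (x mod p) - + x
      eq = begin
        - (+ q * + p)               ≡⟨ lemma (+ r) (+ q) (+ p) ⟩
        + r - (+ r + + q * + p)     ≡⟨ cong (λ t → + r - (+ r + t)) (ℤP.pos-* q p) ⟨
        + r - (+ r + + (q ℕ.* p))   ≡⟨ cong (λ t → + r - t) (ℤP.pos-+ r (q ℕ.* p)) ⟨
        + r - + (r ℕ.+ q ℕ.* p)     ≡⟨ cong₂ (λ t u → + t - + u) (mod≡% x p) (ℕDM.m≡m%n+[m/n]*n x p) ⟨
        + (x mod p) - + x           ∎
        where open ≡-Reasoning

    mod-< : ∀ x → x mod p ℕ.< p
    mod-< x = subst (ℕ._< p) (sym (mod≡% x p)) (ℕDM.m%n<n x p)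

    ≈⇒mod≡ : ∀ {x y} → + x ≈ + y → x mod p ≡ y mod p
    ≈⇒mod≡ {x} {y} x≈y = residue-injective (mod-< x) (mod-< y) (≈-trans (mod-≈ x) (≈-trans x≈y (≈-sym (mod-≈ y))))

    powSum-cong : ∀ k {A B} → powerSum k (map +_ A) ≈ powerSum k (map +_ B) → powSum p k A ≡ powSum p k B
    powSum-cong k {A} {B} A≈B = ≈⇒mod≡ (begin
      + sum (map (ℕ._^ k) A) ≡⟨ pos-sum-^ k A ⟩
      powerSum k (map +_ A)  ≈⟨ A≈B ⟩
      powerSum k (map +_ B)  ≡⟨ pos-sum-^ k B ⟨
      + sum (map (ℕ._^ k) B) ∎)
      where open ≈-Reasoning

    residue≉0 : ∀ {a} → 0 ℕ.< a → a ℕ.< p → ¬ (+ a ≈ 0ℤ)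
    residue≉0 0<a a<p a≈0 = ℕP.<⇒≢ 0<a (sym (residue-injective a<p (ℕ.>-nonZero⁻¹ p) a≈0))

    negp-< : ∀ {a} → a ℕ.< p → negp p a ℕ.< p
    negp-< {zero}  _   = ℕ.>-nonZero⁻¹ p
    negp-< {suc a} a<p = ℕP.∸-monoʳ-< (s≤s z≤n) (ℕP.<⇒≤ a<p)

    negp-scale : ∀ s {x} → x ℕ.< p → negp p ((s ℕ.* x) mod p) ≡ (s ℕ.* negp p x) mod p
    negp-scale s {x} x<p = residue-injective (negp-< (mod-< _)) (mod-< _) (begin
      + negp p ((s ℕ.* x) mod p)  ≈⟨ negp-≈ (ℕP.<⇒≤ (mod-< _)) ⟩
      - + ((s ℕ.* x) mod p)      ≈⟨ -‿cong (mod-≈ (s ℕ.* x)) ⟩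
      - + (s ℕ.* x)              ≡⟨ cong -_ (ℤP.pos-* s x) ⟩
      - (+ s * + x)              ≡⟨ ℤP.neg-distribʳ-* (+ s) (+ x) ⟩
      + s * - + x                ≈⟨ *-congˡ (+ s) (negp-≈ (ℕP.<⇒≤ x<p)) ⟨
      + s * + negp p x           ≡⟨ ℤP.pos-* s (negp p x) ⟨
      + (s ℕ.* negp p x)         ≈⟨ mod-≈ (s ℕ.* negp p x) ⟨
      + ((s ℕ.* negp p x) mod p) ∎)
      where open ≈-Reasoning

  eval-cong : ∀ f g {x} → (∀ k → coeff f k ≈ coeff g k) → eval f x ≈ eval g x
  eval-cong []      []      f≈g = ≈-refl
  eval-cong []      (b ∷ g) {x} f≈g =
    ≈-trans (≈-reflexive (sym (0+x*0≡0 x))) (+-cong (f≈g 0) (*-congˡ x (eval-cong [] g (f≈g ∘ suc))))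
  eval-cong (a ∷ f) []      {x} f≈g =
    ≈-trans (+-cong (f≈g 0) (*-congˡ x (eval-cong f [] (f≈g ∘ suc)))) (≈-reflexive (0+x*0≡0 x))
  eval-cong (a ∷ f) (b ∷ g) {x} f≈g = +-cong (f≈g 0) (*-congˡ x (eval-cong f g (f≈g ∘ suc)))

  mulLinear-cong≈ : ∀ {r s c d} → r ≈ s → (∀ k → c k ≈ d k) → ∀ k → mulLinear r c k ≈ mulLinear s d k
  mulLinear-cong≈ r≈s c≈d zero    = *-cong (-‿cong r≈s) (c≈d zero)
  mulLinear-cong≈ r≈s c≈d (suc k) = +-cong (*-cong (-‿cong r≈s) (c≈d (suc k))) (c≈d k)

  -- (x - r)·(f - g) ≈ 0 gives dₖ ≈ r·dₖ₊₁ for d = f - g; iterating past both degrees gives dₖ ≈ 0.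
  mulLinear-cancel : ∀ r f g → (∀ k → mulLinear r (coeff f) k ≈ mulLinear r (coeff g) k) →
                     ∀ k → coeff f k ≈ coeff g k
  mulLinear-cancel r f g rf≈rg k = -≈0⇒≈ (begin
    d k                ≈⟨ iterate M k ⟩
    r ^ M * d (k ℕ.+ M) ≡⟨ cong (r ^ M *_) d-beyond ⟩
    r ^ M * 0ℤ         ≡⟨ ℤP.*-zeroʳ (r ^ M) ⟩
    0ℤ                 ∎)
    where
    open ≈-Reasoning
    d : ℕ → ℤ
    d k = coeff f k - coeff g k
    step : ∀ k → d k ≈ r * d (suc k)
    step k = -≈0⇒≈ (≈-trans (≈-reflexive (lemma r (coeff f k) (coeff f (suc k)) (coeff g k) (coeff g (suc k))))
                            (≈⇒-≈0 (rf≈rg (suc k))))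
      where lemma : ∀ r a₀ a₁ b₀ b₁ → (a₀ - b₀) - r * (a₁ - b₁) ≡ (- r * a₁ + a₀) - (- r * b₁ + b₀)
            lemma = solve-∀
    iterate : ∀ m k → d k ≈ r ^ m * d (k ℕ.+ m)
    iterate zero    k = ≈-reflexive (trans (cong d (sym (ℕP.+-identityʳ k))) (sym (ℤP.*-identityˡ _)))
    iterate (suc m) k = begin
      d k                            ≈⟨ iterate m k ⟩
      r ^ m * d (k ℕ.+ m)            ≈⟨ *-congˡ (r ^ m) (step (k ℕ.+ m)) ⟩
      r ^ m * (r * d (suc (k ℕ.+ m))) ≡⟨ lemma r (r ^ m) (d (suc (k ℕ.+ m))) ⟩
      r * r ^ m * d (suc (k ℕ.+ m))  ≡⟨ cong (λ i → r ^ suc m * d i) (ℕP.+-suc k m) ⟨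
      r ^ suc m * d (k ℕ.+ suc m)    ∎
      where lemma : ∀ r rᵐ x → rᵐ * (r * x) ≡ r * rᵐ * x
            lemma = solve-∀
    M = length f ℕ.+ length g
    d-beyond : d (k ℕ.+ M) ≡ 0ℤ
    d-beyond = cong₂ _-_ (coeff-beyond-length f _ (ℕP.≤-trans (ℕP.m≤m+n _ _) (ℕP.m≤n+m _ k)))
                         (coeff-beyond-length g _ (ℕP.≤-trans (ℕP.m≤n+m _ (length f)) (ℕP.m≤n+m _ k)))

  coeff-rootProd-cong≈ : ∀ {R S} → Pointwise _≈_ R S → ∀ k → coeff (rootProd R) k ≈ coeff (rootProd S) k
  coeff-rootProd-cong≈ []                              k = ≈-refl
  coeff-rootProd-cong≈ {r ∷ R} {s ∷ S} (r≈s ∷ R≈S) k = begin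
    coeff (linear r *ₚ rootProd R) k    ≡⟨ coeff-linear-*ₚ r (rootProd R) k ⟩
    mulLinear r (coeff (rootProd R)) k  ≈⟨ mulLinear-cong≈ r≈s (coeff-rootProd-cong≈ R≈S) k ⟩
    mulLinear s (coeff (rootProd S)) k  ≡⟨ coeff-linear-*ₚ s (rootProd S) k ⟨
    coeff (linear s *ₚ rootProd S) k    ∎
    where open ≈-Reasoning

  sumBelow-cong≈ : ∀ k {f g} → (∀ j → j ℕ.< k → f j ≈ g j) → sumBelow k f ≈ sumBelow k g
  sumBelow-cong≈ zero    f≈g = ≈-refl
  sumBelow-cong≈ (suc k) f≈g = +-cong (f≈g 0 (s≤s z≤n)) (sumBelow-cong≈ k (λ j j<k → f≈g (suc j) (s≤s j<k)))

  powerSum-cong : ∀ m R S → (∀ j → j ℕ.< m → elemSym (suc j) R ≈ elemSym (suc j) S) →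
                  ∀ k → k ℕ.< m → powerSum (suc k) R ≈ powerSum (suc k) S
  powerSum-cong m R S e≈ = <-rec _ step
    where
    step : ∀ k → (∀ {i} → i ℕ.< k → i ℕ.< m → powerSum (suc i) R ≈ powerSum (suc i) S) →
           k ℕ.< m → powerSum (suc k) R ≈ powerSum (suc k) S
    step k ih k<m = begin
      powerSum (suc k) R
        ≡⟨ powerSum-newton k R ⟩
      - (+ suc k * elemSym (suc k) R) - sumBelow k (λ j → elemSym (suc j) R * powerSum (k ∸ j) R)
        ≈⟨ +-cong (-‿cong (*-congˡ (+ suc k) (e≈ k k<m))) (-‿cong (sumBelow-cong≈ k term≈)) ⟩
      - (+ suc k * elemSym (suc k) S) - sumBelow k (λ j → elemSym (suc j) S * powerSum (k ∸ j) S)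
        ≡⟨ powerSum-newton k S ⟨
      powerSum (suc k) S ∎
      where
      open ≈-Reasoning
      term≈ : ∀ j → j ℕ.< k → elemSym (suc j) R * powerSum (k ∸ j) R ≈ elemSym (suc j) S * powerSum (k ∸ j) S
      term≈ j j<k rewrite ℕP.+-∸-assoc 1 j<k =
        *-cong (e≈ j (ℕP.<-trans j<k k<m)) (ih (ℕP.∸-monoʳ-< (s≤s z≤n) j<k) (ℕP.≤-<-trans (ℕP.m∸n≤m k (suc j)) k<m))

  powerSum-agree : ∀ {m} R S → length R ≡ suc m → length S ≡ suc m →
                   (∀ i → coeff (rootProd R) (suc i) ≈ coeff (rootProd S) (suc i)) →
                   ∀ k → k ℕ.< m → powerSum (suc k) R ≈ powerSum (suc k) S
  powerSum-agree {m} R S |R|≡1+m |S|≡1+m R≈S = powerSum-cong m R S elemSym≈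
    where
    elemSym≈ : ∀ j → j ℕ.< m → elemSym (suc j) R ≈ elemSym (suc j) S
    elemSym≈ j j<m = begin
      elemSym (suc j) R                    ≡⟨ coeff-rootProd R (suc i) (suc j) (trans i+j≡m (sym |R|≡1+m)) ⟨
      coeff (rootProd R) (suc i)           ≈⟨ R≈S i ⟩
      coeff (rootProd S) (suc i)           ≡⟨ coeff-rootProd S (suc i) (suc j) (trans i+j≡m (sym |S|≡1+m)) ⟩
      elemSym (suc j) S                    ∎
      where
      open ≈-Reasoning
      i = m ∸ suc j
      i+j≡m : suc i ℕ.+ suc j ≡ suc m
      i+j≡m = cong suc (trans (ℕP.+-comm i (suc j)) (ℕP.m+[n∸m]≡n j<m))

module PrimeField {p : ℕ} (p-prime : Prime p) where

  open import Data.Integer using (_+_; _*_; _^_; ∣_∣)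
  open Congruence p

  1<p : 1 ℕ.< p
  1<p = ℕ.nonTrivial⇒n>1 p ⦃ prime⇒nonTrivial p-prime ⦄

  instance
    p-nonZero : ℕ.NonZero p
    p-nonZero = ℕ.>-nonZero (ℕP.<-trans (s≤s z≤n) 1<p)

  zero-product : ∀ {x y} → x * y ≈ 0ℤ → x ≈ 0ℤ ⊎ y ≈ 0ℤ
  zero-product {x} {y} xy≈0 with euclidsLemma ∣ x ∣ ∣ y ∣ p-prime p∣∣xy∣
    where
    p∣∣xy∣ : p ℕD.∣ ∣ x ∣ ℕ.* ∣ y ∣
    p∣∣xy∣ = subst (p ℕD.∣_) (ℤP.abs-* x y) (≈0⇒∣ᵤ xy≈0)
  ... | inj₁ p∣x = inj₁ (∣⇒≈ (ℤD.∣ᵤ⇒∣ p∣x))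
  ... | inj₂ p∣y = inj₂ (∣⇒≈ (ℤD.∣ᵤ⇒∣ p∣y))

  *-cancelˡ : ∀ {u x y} → ¬ (u ≈ 0ℤ) → u * x ≈ u * y → x ≈ y
  *-cancelˡ {u} {x} {y} u≉0 ux≈uy with zero-product (≈-trans (≈-reflexive (lemma u x y)) (≈⇒-≈0 ux≈uy))
    where lemma : ∀ u x y → u * (x - y) ≡ u * x - u * y
          lemma = solve-∀
  ... | inj₁ u≈0   = ⊥-elim (u≉0 u≈0)
  ... | inj₂ x-y≈0 = -≈0⇒≈ x-y≈0

  1≉0 : ¬ (1ℤ ≈ 0ℤ)
  1≉0 1≈0 = ℕP.<⇒≢ 1<p (sym (ℕD.∣1⇒≡1 (≈0⇒∣ᵤ 1≈0)))

  ^-≉0 : ∀ {x} m → ¬ (x ≈ 0ℤ) → ¬ (x ^ m ≈ 0ℤ)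
  ^-≉0 zero    x≉0 = 1≉0
  ^-≉0 (suc m) x≉0 xxᵐ≈0 with zero-product xxᵐ≈0
  ... | inj₁ x≈0  = x≉0 x≈0
  ... | inj₂ xᵐ≈0 = ^-≉0 m x≉0 xᵐ≈0

  rootProd-root : ∀ R {x} → eval (rootProd R) x ≈ 0ℤ → ∃[ r ] (r ∈ R × x ≈ r)
  rootProd-root []      {x} ev≈0 = ⊥-elim (1≉0 (≈-trans (≈-reflexive (sym (eval-rootProd-[] x))) ev≈0))
  rootProd-root (r ∷ R) {x} ev≈0 with zero-product (≈-trans (≈-reflexive (sym (eval-linear-*ₚ r (rootProd R) x))) ev≈0)
  ... | inj₁ x-r≈0 = r , here refl , -≈0⇒≈ x-r≈0
  ... | inj₂ ev′≈0 with rootProd-root R ev′≈0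
  ...   | s , s∈R , x≈s = s , there s∈R , x≈s

  rootProd-injective : ∀ {A B} → All (ℕ._< p) A → All (ℕ._< p) B →
                       (∀ k → coeff (rootProd (map +_ A)) k ≈ coeff (rootProd (map +_ B)) k) → A ↭ B
  rootProd-injective {[]}    {[]}    _ _ _ = ↭.refl
  rootProd-injective {[]}    {b ∷ B} _ _ A≈B = ⊥-elim (1≉0 (begin
    1ℤ                                   ≡⟨ eval-rootProd-[] (+ b) ⟨
    eval (rootProd []) (+ b)             ≈⟨ eval-cong (rootProd []) (rootProd (map +_ (b ∷ B))) A≈B ⟩
    eval (rootProd (map +_ (b ∷ B))) (+ b) ≡⟨ eval-rootProd-∈ {R = map +_ (b ∷ B)} (here refl) ⟩
    0ℤ                                   ∎))
    where open ≈-Reasoning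
  rootProd-injective {a ∷ A} {B} (a<p ∷ A<p) B<p A≈B
    with rootProd-root (map +_ B) (≈-trans (≈-sym (eval-cong (rootProd (map +_ (a ∷ A))) (rootProd (map +_ B)) A≈B))
                                      (≈-reflexive (eval-rootProd-∈ {R = map +_ (a ∷ A)} (here refl))))
  ... | r , r∈B , a≈r with ∈-map⁻ +_ r∈B
  ...   | b , b∈B , refl with residue-injective a<p (All.lookup B<p b∈B) a≈r
  ...     | refl with ∈-∃++ b∈B
  ...       | B₁ , B₂ , refl = ↭.trans (↭.prep a (rootProd-injective A<p B′<p A≈B′)) (↭.↭-sym σ)
    where
    σ : B₁ ++ a ∷ B₂ ↭ a ∷ B₁ ++ B₂
    σ = shift a B₁ B₂
    B′<p : All (ℕ._< p) (B₁ ++ B₂)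
    B′<p = All.tail (All-resp-↭ σ B<p)
    A≈B′ : ∀ k → coeff (rootProd (map +_ A)) k ≈ coeff (rootProd (map +_ (B₁ ++ B₂))) k
    A≈B′ = mulLinear-cancel (+ a) (rootProd (map +_ A)) (rootProd (map +_ (B₁ ++ B₂))) λ k → begin
      mulLinear (+ a) (coeff (rootProd (map +_ A))) k ≡⟨ coeff-linear-*ₚ (+ a) (rootProd (map +_ A)) k ⟨
      coeff (rootProd (map +_ (a ∷ A))) k            ≈⟨ A≈B k ⟩
      coeff (rootProd (map +_ (B₁ ++ a ∷ B₂))) k      ≡⟨ coeff-rootProd-↭ (map⁺ +_ σ) k ⟩
      coeff (rootProd (map +_ (a ∷ B₁ ++ B₂))) k      ≡⟨ coeff-linear-*ₚ (+ a) (rootProd (map +_ (B₁ ++ B₂))) k ⟩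
      mulLinear (+ a) (coeff (rootProd (map +_ (B₁ ++ B₂)))) k ∎
      where open ≈-Reasoning

module ChebyshevRoots {p : ℕ} (p-prime : Prime p) (2<p : 2 ℕ.< p) (n c : ℕ) {A : List ℕ}
                      (split : RootMultisetSplit p (T n -ₚ (+ c ∷ [])) A) where

  open import Data.Integer using (_+_; _*_; _^_)
  open Congruence p
  open PrimeField p-prime

  private
    A′ = map +_ A
    f  = T n -ₚ (+ c ∷ [])

  A<p : All (ℕ._< p) A
  A<p = proj₁ split

  unit : ℤ
  unit = proj₁ (proj₂ split)

  unit≉0 : ¬ (unit ≈ 0ℤ)
  unit≉0 u≈0 = proj₁ (proj₂ (proj₂ split)) (≈0⇒∣ᵤ u≈0)

  coeff-split : ∀ k → coeff f k ≈ unit * coeff (rootProd A′) k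
  coeff-split k = ≈-trans (mk (ℤD.∣ᵤ⇒∣ (proj₂ (proj₂ (proj₂ split)) k)))
    (≈-reflexive (trans (coeff-scalarₚ unit (linProd A) k) (cong (λ g → unit * coeff g k) (linProd≡rootProd A))))

  length≡n : length A ≡ n
  length≡n with ℕP.<-cmp (length A) n
  ... | tri≈ _ |A|≡n _ = |A|≡n
  ... | tri< |A|<n _ _ = ⊥-elim (^-≉0 (ℕ.pred n) (residue≉0 (s≤s z≤n) 2<p) (begin
    (+ 2) ^ ℕ.pred n             ≡⟨ coeff-T-const-leading n (+ c) (ℕP.<-≤-trans (s≤s z≤n) |A|<n) ⟨
    coeff f n                    ≈⟨ coeff-split n ⟩
    unit * coeff (rootProd A′) n ≡⟨ cong (unit *_) (coeff-rootProd-beyond A′ n (subst (ℕ._< n) (sym (length-map +_ A)) |A|<n)) ⟩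
    unit * 0ℤ                    ≡⟨ ℤP.*-zeroʳ unit ⟩
    0ℤ                           ∎))
    where open ≈-Reasoning
  ... | tri> _ _ n<|A| = ⊥-elim (unit≉0 (begin
    unit                                   ≡⟨ ℤP.*-identityʳ unit ⟨
    unit * 1ℤ                              ≡⟨ cong (unit *_) (coeff-rootProd A′ (length A) 0 (trans (ℕP.+-identityʳ _) (sym (length-map +_ A)))) ⟨
    unit * coeff (rootProd A′) (length A)  ≈⟨ coeff-split (length A) ⟨
    coeff f (length A)                     ≡⟨ coeff-T-const-beyond n (+ c) (length A) n<|A| ⟩
    0ℤ                                     ∎))
    where open ≈-Reasoning

  root-value : ∀ {a} → a ∈ A → eval (T n) (+ a) ≈ + c
  root-value {a} a∈A = -≈0⇒≈ (begin
    eval (T n) (+ a) - + c                          ≡⟨ cong (λ t → eval (T n) (+ a) - t) (trans (cong (λ t → + c + t) (ℤP.*-zeroʳ (+ a))) (ℤP.+-identityʳ (+ c))) ⟨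
    eval (T n) (+ a) - eval (+ c ∷ []) (+ a)         ≡⟨ eval--ₚ (T n) (+ c ∷ []) (+ a) ⟨
    eval f (+ a)                                    ≈⟨ eval-cong f (scalarₚ unit (rootProd A′)) (λ k → ≈-trans (coeff-split k) (≈-reflexive (sym (coeff-scalarₚ unit (rootProd A′) k)))) ⟩
    eval (scalarₚ unit (rootProd A′)) (+ a)          ≡⟨ eval-scalarₚ unit (rootProd A′) (+ a) ⟩
    unit * eval (rootProd A′) (+ a)                  ≡⟨ cong (unit *_) (eval-rootProd-∈ (∈-map⁺ +_ a∈A)) ⟩
    unit * 0ℤ                                        ≡⟨ ℤP.*-zeroʳ unit ⟩
    0ℤ                                               ∎)
    where open ≈-Reasoning

  private
    coeff-even : 2 ℕD.∣ n → ∀ k → coeff (rootProd A′) k ≈ (- 1ℤ) ^ k * coeff (rootProd A′) k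
    coeff-even (ℕD.divides q refl) k = *-cancelˡ unit≉0 (begin
      unit * coeff (rootProd A′) k                ≈⟨ coeff-split k ⟨
      coeff f k                                   ≡⟨ coeff-T-const-even q (+ c) k ⟩
      (- 1ℤ) ^ k * coeff f k                      ≈⟨ *-congˡ ((- 1ℤ) ^ k) (coeff-split k) ⟩
      (- 1ℤ) ^ k * (unit * coeff (rootProd A′) k) ≡⟨ lemma ((- 1ℤ) ^ k) unit (coeff (rootProd A′) k) ⟩
      unit * ((- 1ℤ) ^ k * coeff (rootProd A′) k) ∎)
      where
      open ≈-Reasoning
      lemma : ∀ s u x → s * (u * x) ≡ u * (s * x)
      lemma = solve-∀

  symmetric : 2 ℕD.∣ n → map (negp p) A ↭ A
  symmetric 2∣n@(ℕD.divides q n≡q*2) = rootProd-injective (AllP.map⁺ (All.map negp-< A<p)) A<p negated≈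
    where
    sign : ∀ k → (- 1ℤ) ^ (length A′ ℕ.+ k) ≡ (- 1ℤ) ^ k
    sign k = begin
      (- 1ℤ) ^ (length A′ ℕ.+ k)          ≡⟨ ℤP.^-distribˡ-+-* (- 1ℤ) (length A′) k ⟩
      (- 1ℤ) ^ length A′ * (- 1ℤ) ^ k     ≡⟨ cong (λ m → (- 1ℤ) ^ m * (- 1ℤ) ^ k) (trans (length-map +_ A) (trans length≡n n≡q*2)) ⟩
      (- 1ℤ) ^ (q ℕ.* 2) * (- 1ℤ) ^ k     ≡⟨ cong (_* (- 1ℤ) ^ k) (-1^[q*2]≡1 q) ⟩
      1ℤ * (- 1ℤ) ^ k                     ≡⟨ ℤP.*-identityˡ _ ⟩
      (- 1ℤ) ^ k                          ∎
      where open ≡-Reasoning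
    negated≈ : ∀ k → coeff (rootProd (map +_ (map (negp p) A))) k ≈ coeff (rootProd A′) k
    negated≈ k = begin
      coeff (rootProd (map +_ (map (negp p) A))) k        ≈⟨ coeff-rootProd-cong≈ (negp-pointwise A<p) k ⟩
      coeff (rootProd (map -_ A′)) k                      ≡⟨ coeff-rootProd-map-neg A′ k ⟩
      (- 1ℤ) ^ (length A′ ℕ.+ k) * coeff (rootProd A′) k  ≡⟨ cong (_* coeff (rootProd A′) k) (sign k) ⟩
      (- 1ℤ) ^ k * coeff (rootProd A′) k                  ≈⟨ coeff-even 2∣n k ⟨
      coeff (rootProd A′) k                               ∎
      where open ≈-Reasoning

  unit≈leading : unit ≈ coeff f n
  unit≈leading = begin
    unit                          ≡⟨ ℤP.*-identityʳ unit ⟨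
    unit * 1ℤ                     ≡⟨ cong (unit *_) (coeff-rootProd A′ n 0 (trans (ℕP.+-identityʳ n) (sym (trans (length-map +_ A) length≡n)))) ⟨
    unit * coeff (rootProd A′) n  ≈⟨ coeff-split n ⟨
    coeff f n                     ∎
    where open ≈-Reasoning

  coeff-split-suc : ∀ k → unit * coeff (rootProd A′) (suc k) ≈ coeff (T n) (suc k)
  coeff-split-suc k = ≈-trans (≈-sym (coeff-split (suc k))) (≈-reflexive (coeff--ₚ-const (T n) (+ c) k))

chebyshev-powSum : ∀ {p} → Prime p → 2 ℕ.< p → ∀ n {c₁ c₂ A B} →
                   RootMultisetSplit p (T n -ₚ (+ c₁ ∷ [])) A → RootMultisetSplit p (T n -ₚ (+ c₂ ∷ [])) B →
                   ∀ k → 1 ℕ.≤ k → k ℕ.< n → powSum p k A ≡ powSum p k B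
chebyshev-powSum {p} p-prime 2<p (suc m) {c₁} {c₂} {A} {B} splitA splitB (suc k) _ (s≤s k<m) =
  powSum-cong (suc k) {A} {B} (powerSum-agree (map +_ A) (map +_ B) (|R|≡ {A} RA.length≡n) (|R|≡ {B} RB.length≡n) coeffs≈ k k<m)
  where
  open import Data.Integer using (_*_)
  open Congruence p
  open PrimeField p-prime
  module RA = ChebyshevRoots p-prime 2<p (suc m) c₁ splitA
  module RB = ChebyshevRoots p-prime 2<p (suc m) c₂ splitB
  |R|≡ : ∀ {R} → length R ≡ suc m → length (map +_ R) ≡ suc m
  |R|≡ {R} eq = trans (length-map +_ R) eq
  units≈ : RA.unit ≈ RB.unit
  units≈ = begin
    RA.unit                                ≈⟨ RA.unit≈leading ⟩
    coeff (T (suc m) -ₚ (+ c₁ ∷ [])) (suc m) ≡⟨ coeff--ₚ-const (T (suc m)) (+ c₁) m ⟩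
    coeff (T (suc m)) (suc m)              ≡⟨ coeff--ₚ-const (T (suc m)) (+ c₂) m ⟨
    coeff (T (suc m) -ₚ (+ c₂ ∷ [])) (suc m) ≈⟨ RB.unit≈leading ⟨
    RB.unit                                ∎
    where open ≈-Reasoning
  coeffs≈ : ∀ i → coeff (rootProd (map +_ A)) (suc i) ≈ coeff (rootProd (map +_ B)) (suc i)
  coeffs≈ i = *-cancelˡ RA.unit≉0 (begin
    RA.unit * coeff (rootProd (map +_ A)) (suc i) ≈⟨ RA.coeff-split-suc i ⟩
    coeff (T (suc m)) (suc i)                    ≈⟨ RB.coeff-split-suc i ⟨
    RB.unit * coeff (rootProd (map +_ B)) (suc i) ≈⟨ *-congʳ _ units≈ ⟨
    RA.unit * coeff (rootProd (map +_ B)) (suc i) ∎)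
    where open ≈-Reasoning

chebyshev-symmetricIdealPTE : ∀ {p n c₁ c₂ A B} → Prime p → 2 ℕ.< p → 2 ℕD.∣ n → c₁ ℕ.< p → c₂ ℕ.< p → c₁ ≢ c₂ →
                              RootMultisetSplit p (T n -ₚ (+ c₁ ∷ [])) A → RootMultisetSplit p (T n -ₚ (+ c₂ ∷ [])) B →
                              SymIdealPTE p n A B
chebyshev-symmetricIdealPTE {p} {n} {c₁} {c₂} {A} {B} p-prime 2<p 2∣n c₁<p c₂<p c₁≢c₂ splitA splitB = record
  { ideal = record
    { A-inFp   = RA.A<p
    ; B-inFp   = RB.A<p
    ; sizeA    = RA.length≡n
    ; sizeB    = RB.length≡n
    ; disjoint = λ a∈A b∈B a≡b → c₁≢c₂ (residue-injective c₁<p c₂<p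
                   (≈-trans (≈-sym (RA.root-value a∈A)) (RB.root-value (subst (_∈ B) (sym a≡b) b∈B))))
    ; powers   = chebyshev-powSum p-prime 2<p n splitA splitB
    }
  ; symA  = RA.symmetric 2∣n
  ; symB  = RB.symmetric 2∣n
  }
  where
  open Congruence p
  module RA = ChebyshevRoots p-prime 2<p n c₁ splitA
  module RB = ChebyshevRoots p-prime 2<p n c₂ splitB

applyUpTo-cong : ∀ {X : Set} {f g : ℕ → X} m → (∀ i → f i ≡ g i) → applyUpTo f m ≡ applyUpTo g m
applyUpTo-cong m f≗g = trans (sym (map-upTo _ m)) (trans (map-cong f≗g (upTo m)) (map-upTo _ m))

applyUpTo-++ : ∀ {X : Set} (f : ℕ → X) m m′ → applyUpTo f (m ℕ.+ m′) ≡ applyUpTo f m ++ applyUpTo (f ∘ (m ℕ.+_)) m′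
applyUpTo-++ f zero    m′ = refl
applyUpTo-++ f (suc m) m′ = cong (f 0 ∷_) (applyUpTo-++ (f ∘ suc) m m′)

applyUpTo-rotate : ∀ {X : Set} (f : ℕ → X) q r → (∀ i → f (q ℕ.+ r ℕ.+ i) ≡ f i) →
                   applyUpTo (f ∘ (q ℕ.+_)) (q ℕ.+ r) ↭ applyUpTo f (q ℕ.+ r)
applyUpTo-rotate f q r periodic = begin
  applyUpTo (f ∘ (q ℕ.+_)) (q ℕ.+ r)                     ≡⟨ cong (applyUpTo (f ∘ (q ℕ.+_))) (ℕP.+-comm q r) ⟩
  applyUpTo (f ∘ (q ℕ.+_)) (r ℕ.+ q)                     ≡⟨ applyUpTo-++ (f ∘ (q ℕ.+_)) r q ⟩
  applyUpTo (f ∘ (q ℕ.+_)) r ++ applyUpTo (λ i → f (q ℕ.+ (r ℕ.+ i))) q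
    ≡⟨ cong (applyUpTo (f ∘ (q ℕ.+_)) r ++_) (applyUpTo-cong q (λ i → trans (cong f (sym (ℕP.+-assoc q r i))) (periodic i))) ⟩
  applyUpTo (f ∘ (q ℕ.+_)) r ++ applyUpTo f q            ↭⟨ ++-comm (applyUpTo (f ∘ (q ℕ.+_)) r) (applyUpTo f q) ⟩
  applyUpTo f q ++ applyUpTo (f ∘ (q ℕ.+_)) r            ≡⟨ applyUpTo-++ f q r ⟨
  applyUpTo f (q ℕ.+ r)                                  ∎
  where open ↭.PermutationReasoning

length-filter-+-∁ : ∀ {X : Set} {P : X → Set} (P? : Decidable P) xs →
                    length (filter P? xs) ℕ.+ length (filter (∁? P?) xs) ≡ length xs
length-filter-+-∁ P? []       = refl
length-filter-+-∁ P? (x ∷ xs) with P? x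
... | yes _ = cong suc (length-filter-+-∁ P? xs)
... | no  _ = trans (ℕP.+-suc _ _) (cong suc (length-filter-+-∁ P? xs))

Unique-⊆⇒length≤ : ∀ {X : Set} {xs ys : List X} → Unique xs → (∀ {x} → x ∈ xs → x ∈ ys) → length xs ℕ.≤ length ys
Unique-⊆⇒length≤ {xs = []}     _            _  = z≤n
Unique-⊆⇒length≤ {xs = x ∷ xs} (x∉xs ∷ xs!) xs⊆ys with ys₁ , ys₂ , refl ← ∈-∃++ (xs⊆ys (here refl)) =
  subst (suc (length xs) ℕ.≤_) (sym (length-++-sucʳ ys₁ x ys₂)) (s≤s (Unique-⊆⇒length≤ xs! xs⊆ys₁++ys₂))
  where
  xs⊆ys₁++ys₂ : ∀ {y} → y ∈ xs → y ∈ ys₁ ++ ys₂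
  xs⊆ys₁++ys₂ y∈xs with ∈-++⁻ ys₁ (xs⊆ys (there y∈xs))
  ... | inj₁ y∈ys₁         = ∈-++⁺ˡ y∈ys₁
  ... | inj₂ (here refl)   = ⊥-elim (All.lookup x∉xs y∈xs refl)
  ... | inj₂ (there y∈ys₂) = ∈-++⁺ʳ ys₁ y∈ys₂

remaining-≥ : ∀ {r n U C} → U ℕ.< n → U ℕ.+ C ≡ r ℕ.* n → r ℕ.≤ C
remaining-≥ {zero}                  _   _  = z≤n
remaining-≥ {suc r} {suc n} {U} {C} U<n eq = ℕP.≮⇒≥ λ C<1+r → ℕP.<-irrefl eq (begin-strict
  U ℕ.+ C            ≤⟨ ℕP.+-mono-≤ (ℕP.≤-pred U<n) (ℕP.≤-pred C<1+r) ⟩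
  n ℕ.+ r            <⟨ s≤s (ℕP.+-monoʳ-≤ n (ℕP.m≤m*n r (suc n))) ⟩
  suc r ℕ.* suc n    ∎)
  where open ℕP.≤-Reasoning

avoiding-≥ : ∀ {r n m} (xs : List ℕ) → length xs ≡ n → m ∈ xs → m ≡ r ℕ.* n →
             r ℕ.≤ length (filter (λ s → ¬? (s ∈? xs)) (upTo m))
avoiding-≥ {r} {n} {m} xs |xs|≡n m∈xs m≡r*n =
  remaining-≥ in-xs<n (trans (length-filter-+-∁ (_∈? xs) (upTo m)) (trans (length-upTo m) m≡r*n))
  where
  in-xs = filter (_∈? xs) (upTo m)
  ≢m? = λ x → ¬? (x ℕP.≟ m)
  in-xs⊆ : ∀ {x} → x ∈ in-xs → x ∈ filter ≢m? xs
  in-xs⊆ x∈ with x∈upTo , x∈xs ← ∈-filter⁻ (_∈? xs) {xs = upTo m} x∈ = ∈-filter⁺ ≢m? x∈xs (ℕP.<⇒≢ (∈-upTo⁻ x∈upTo))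
  in-xs<n : length in-xs ℕ.< n
  in-xs<n = begin-strict
    length in-xs            ≤⟨ Unique-⊆⇒length≤ (UniqueP.filter⁺ (_∈? xs) (UniqueP.upTo⁺ m)) in-xs⊆ ⟩
    length (filter ≢m? xs)  <⟨ filter-notAll ≢m? xs (Any.map (λ m≡x x≢m → x≢m (sym m≡x)) m∈xs) ⟩
    length xs               ≡⟨ |xs|≡n ⟩
    n                       ∎
    where open ℕP.≤-Reasoning

0∈take-filter-upTo : ∀ {P : ℕ → Set} (P? : Decidable P) → P 0 → ∀ {r m} → 1 ℕ.≤ r → 1 ℕ.≤ m → 0 ∈ take r (filter P? (upTo m))
0∈take-filter-upTo P? P0 {suc r} {suc m} _ _ rewrite filter-accept P? {xs = applyUpTo suc m} P0 = here refl

module RootsOfUnity {p : ℕ} (p-prime : Prime p) {a n : ℕ} ⦃ _ : ℕ.NonZero n ⦄ (order : HasOrder p a n) where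

  open import Data.Integer using (_+_; _*_; _^_)
  open Congruence p
  open PrimeField p-prime

  private
    α : ℤ
    α = + a

  power : ℕ → ℕ
  power i = (a ℕ.^ i) mod p

  μ : List ℕ
  μ = map power (upTo n)

  power≈ : ∀ i → + power i ≈ α ^ i
  power≈ i = ≈-trans (mod-≈ (a ℕ.^ i)) (≈-reflexive (pos-^ a i))

  α^n≈1 : α ^ n ≈ 1ℤ
  α^n≈1 = ≈-trans (≈-sym (power≈ n)) (≈-reflexive (cong +_ (proj₁ (proj₂ order))))

  α^k≉1 : ∀ k → 1 ℕ.≤ k → k ℕ.< n → ¬ (α ^ k ≈ 1ℤ)
  α^k≉1 k 1≤k k<n α^k≈1 = proj₂ (proj₂ order) k 1≤k k<n (residue-injective (mod-< _) 1<p (≈-trans (power≈ k) α^k≈1))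

  α≉0 : ¬ (α ≈ 0ℤ)
  α≉0 α≈0 = 1≉0 (begin
    1ℤ                     ≈⟨ α^n≈1 ⟨
    α ^ n                  ≡⟨ cong (α ^_) (ℕP.suc-pred n) ⟨
    α * α ^ ℕ.pred n       ≈⟨ *-congʳ (α ^ ℕ.pred n) α≈0 ⟩
    0ℤ * α ^ ℕ.pred n      ≡⟨ ℤP.*-zeroˡ (α ^ ℕ.pred n) ⟩
    0ℤ                     ∎)
    where open ≈-Reasoning

  α^-mod : ∀ e → α ^ e ≈ α ^ (e ℕDM.% n)
  α^-mod e = begin
    α ^ e                                         ≡⟨ cong (α ^_) (ℕDM.m≡m%n+[m/n]*n e n) ⟩
    α ^ (e ℕDM.% n ℕ.+ e ℕDM./ n ℕ.* n)            ≡⟨ ℤP.^-distribˡ-+-* α (e ℕDM.% n) _ ⟩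
    α ^ (e ℕDM.% n) * α ^ (e ℕDM./ n ℕ.* n)        ≡⟨ cong (λ m → α ^ (e ℕDM.% n) * α ^ m) (ℕP.*-comm (e ℕDM./ n) n) ⟩
    α ^ (e ℕDM.% n) * α ^ (n ℕ.* (e ℕDM./ n))      ≡⟨ cong (α ^ (e ℕDM.% n) *_) (ℤP.^-*-assoc α n (e ℕDM./ n)) ⟨
    α ^ (e ℕDM.% n) * (α ^ n) ^ (e ℕDM./ n)        ≈⟨ *-congˡ (α ^ (e ℕDM.% n)) (^-cong (e ℕDM./ n) α^n≈1) ⟩
    α ^ (e ℕDM.% n) * 1ℤ ^ (e ℕDM./ n)             ≡⟨ cong (α ^ (e ℕDM.% n) *_) (ℤP.^-zeroˡ (e ℕDM./ n)) ⟩
    α ^ (e ℕDM.% n) * 1ℤ                          ≡⟨ ℤP.*-identityʳ _ ⟩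
    α ^ (e ℕDM.% n)                               ∎
    where open ≈-Reasoning

  power∈μ : ∀ e → power e ∈ μ
  power∈μ e = subst (_∈ μ) power-mod (∈-map⁺ power (∈-upTo⁺ (ℕDM.m%n<n e n)))
    where
    power-mod : power (e ℕDM.% n) ≡ power e
    power-mod = residue-injective (mod-< _) (mod-< _)
      (≈-trans (power≈ (e ℕDM.% n)) (≈-trans (≈-sym (α^-mod e)) (≈-sym (power≈ e))))

  ∈μ⇒power : ∀ {x} → x ∈ μ → ∃[ i ] (i ℕ.< n × x ≡ power i)
  ∈μ⇒power x∈μ with i , i∈upTo , x≡ ← ∈-map⁻ power x∈μ = i , ∈-upTo⁻ i∈upTo , x≡

  μ<p : All (ℕ._< p) μ
  μ<p = AllP.map⁺ (All.universal (λ i → mod-< (a ℕ.^ i)) (upTo n))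

  length-μ : length μ ≡ n
  length-μ = trans (length-map power (upTo n)) (length-upTo n)

  0∉μ : ¬ (0 ∈ μ)
  0∉μ 0∈μ with i , _ , 0≡ ← ∈μ⇒power 0∈μ = ^-≉0 i α≉0 (≈-trans (≈-sym (power≈ i)) (≈-reflexive (cong +_ (sym 0≡))))

  α^half≈-1 : ∀ {q} → n ≡ q ℕ.* 2 → α ^ q ≈ - 1ℤ
  α^half≈-1 {q} n≡q*2 = [ (λ α^q-1≈0 → ⊥-elim (α^k≉1 q 1≤q q<n (-≈0⇒≈ α^q-1≈0)))
                        , (λ α^q+1≈0 → -≈0⇒≈ (≈-trans (≈-reflexive (x--1≡x+1 (α ^ q))) α^q+1≈0))
                        ]′ (zero-product factored≈0)
    where
    n≡q+q : n ≡ q ℕ.+ q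
    n≡q+q = trans n≡q*2 (trans (ℕP.*-comm q 2) (cong (q ℕ.+_) (ℕP.+-identityʳ q)))
    1≤q : 1 ℕ.≤ q
    1≤q = ℕP.n≢0⇒n>0 (λ q≡0 → ℕ.≢-nonZero⁻¹ n (trans n≡q+q (cong₂ ℕ._+_ q≡0 q≡0)))
    q<n : q ℕ.< n
    q<n = subst (q ℕ.<_) (sym n≡q+q) (ℕP.m<m+n q 1≤q)
    x--1≡x+1 : ∀ x → x - - 1ℤ ≡ x + 1ℤ
    x--1≡x+1 = solve-∀
    difference-of-squares : ∀ x → (x - 1ℤ) * (x + 1ℤ) ≡ x * x - 1ℤ
    difference-of-squares = solve-∀
    factored≈0 : (α ^ q - 1ℤ) * (α ^ q + 1ℤ) ≈ 0ℤ
    factored≈0 = begin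
      (α ^ q - 1ℤ) * (α ^ q + 1ℤ) ≡⟨ difference-of-squares (α ^ q) ⟩
      α ^ q * α ^ q - 1ℤ          ≡⟨ cong (_- 1ℤ) (sym (trans (cong (α ^_) n≡q+q) (ℤP.^-distribˡ-+-* α q q))) ⟩
      α ^ n - 1ℤ                  ≈⟨ ≈⇒-≈0 α^n≈1 ⟩
      0ℤ                          ∎
      where open ≈-Reasoning

  power-periodic : ∀ i → power (n ℕ.+ i) ≡ power i
  power-periodic i = residue-injective (mod-< _) (mod-< _) (begin
    + power (n ℕ.+ i) ≈⟨ power≈ (n ℕ.+ i) ⟩
    α ^ (n ℕ.+ i)     ≡⟨ ℤP.^-distribˡ-+-* α n i ⟩
    α ^ n * α ^ i     ≈⟨ *-congʳ (α ^ i) α^n≈1 ⟩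
    1ℤ * α ^ i        ≡⟨ ℤP.*-identityˡ (α ^ i) ⟩
    α ^ i             ≈⟨ power≈ i ⟨
    + power i         ∎)
    where open ≈-Reasoning

  negp-power : ∀ {q} → n ≡ q ℕ.* 2 → ∀ i → negp p (power i) ≡ power (q ℕ.+ i)
  negp-power {q} n≡q*2 i = residue-injective (negp-< (mod-< _)) (mod-< _) (begin
    + negp p (power i) ≈⟨ negp-≈ (ℕP.<⇒≤ (mod-< _)) ⟩
    - + power i        ≈⟨ -‿cong (power≈ i) ⟩
    - α ^ i            ≡⟨ ℤP.-1*i≡-i (α ^ i) ⟨
    - 1ℤ * α ^ i       ≈⟨ *-congʳ (α ^ i) (α^half≈-1 {q} n≡q*2) ⟨
    α ^ q * α ^ i      ≡⟨ ℤP.^-distribˡ-+-* α q i ⟨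
    α ^ (q ℕ.+ i)      ≈⟨ power≈ (q ℕ.+ i) ⟨
    + power (q ℕ.+ i)  ∎)
    where open ≈-Reasoning

  μ-symmetric : 2 ℕD.∣ n → map (negp p) μ ↭ μ
  μ-symmetric (ℕD.divides q n≡q*2) = begin
    map (negp p) (map power (upTo n))   ≡⟨ map-∘ (upTo n) ⟨
    map (negp p ∘ power) (upTo n)       ≡⟨ map-upTo (negp p ∘ power) n ⟩
    applyUpTo (negp p ∘ power) n        ≡⟨ applyUpTo-cong n (negp-power {q} n≡q*2) ⟩
    applyUpTo (power ∘ (q ℕ.+_)) n      ≡⟨ cong (applyUpTo (power ∘ (q ℕ.+_))) n≡q+q ⟩
    applyUpTo (power ∘ (q ℕ.+_)) (q ℕ.+ q) ↭⟨ applyUpTo-rotate power q q (λ i → trans (cong (λ m → power (m ℕ.+ i)) (sym n≡q+q)) (power-periodic i)) ⟩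
    applyUpTo power (q ℕ.+ q)           ≡⟨ cong (applyUpTo power) n≡q+q ⟨
    applyUpTo power n                   ≡⟨ map-upTo power n ⟨
    map power (upTo n)                  ∎
    where
    open ↭.PermutationReasoning
    n≡q+q : n ≡ q ℕ.+ q
    n≡q+q = trans n≡q*2 (trans (ℕP.*-comm q 2) (cong (q ℕ.+_) (ℕP.+-identityʳ q)))

  scale-symmetric : 2 ℕD.∣ n → ∀ s → map (negp p) (scale p s μ) ↭ scale p s μ
  scale-symmetric 2∣n s = begin
    map (negp p) (map (λ x → (s ℕ.* x) mod p) μ)   ≡⟨ map-∘ μ ⟨
    map (λ x → negp p ((s ℕ.* x) mod p)) μ        ≡⟨ map-cong-local (All.map (negp-scale s) μ<p) ⟩
    map (λ x → (s ℕ.* negp p x) mod p) μ          ≡⟨ map-∘ μ ⟩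
    scale p s (map (negp p) μ)                    ↭⟨ map⁺ (λ x → (s ℕ.* x) mod p) (μ-symmetric 2∣n) ⟩
    scale p s μ                                   ∎
    where open ↭.PermutationReasoning

  p∸1∈μ : 2 ℕD.∣ n → p ∸ 1 ∈ μ
  p∸1∈μ (ℕD.divides q n≡q*2) = subst (_∈ μ) p∸1≡ (power∈μ (q ℕ.+ 0))
    where
    power0≡1 : power 0 ≡ 1
    power0≡1 = residue-injective (mod-< 1) 1<p (mod-≈ 1)
    p∸1≡ : power (q ℕ.+ 0) ≡ p ∸ 1
    p∸1≡ = trans (sym (negp-power {q} n≡q*2 0)) (cong (negp p) power0≡1)

  private
    scaled-power⇒∈μ : ∀ {s} → s ℕ.< p → ∀ i j → j ℕ.< n → power i ≡ (s ℕ.* power j) mod p → s ∈ μ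
    scaled-power⇒∈μ {s} s<p i j j<n i≡sj = subst (_∈ μ) (sym s≡) (power∈μ (i ℕ.+ (n ∸ j)))
      where
      s≈ : + s ≈ α ^ (i ℕ.+ (n ∸ j))
      s≈ = begin
        + s                                ≡⟨ ℤP.*-identityʳ (+ s) ⟨
        + s * 1ℤ                           ≈⟨ *-congˡ (+ s) α^n≈1 ⟨
        + s * α ^ n                        ≡⟨ cong (λ m → + s * α ^ m) (ℕP.m+[n∸m]≡n (ℕP.<⇒≤ j<n)) ⟨
        + s * α ^ (j ℕ.+ (n ∸ j))          ≡⟨ cong (+ s *_) (ℤP.^-distribˡ-+-* α j (n ∸ j)) ⟩
        + s * (α ^ j * α ^ (n ∸ j))        ≡⟨ ℤP.*-assoc (+ s) (α ^ j) (α ^ (n ∸ j)) ⟨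
        + s * α ^ j * α ^ (n ∸ j)          ≈⟨ *-congʳ (α ^ (n ∸ j)) (*-congˡ (+ s) (power≈ j)) ⟨
        + s * + power j * α ^ (n ∸ j)      ≡⟨ cong (_* α ^ (n ∸ j)) (ℤP.pos-* s (power j)) ⟨
        + (s ℕ.* power j) * α ^ (n ∸ j)    ≈⟨ *-congʳ (α ^ (n ∸ j)) (mod-≈ (s ℕ.* power j)) ⟨
        + ((s ℕ.* power j) mod p) * α ^ (n ∸ j) ≡⟨ cong (λ t → + t * α ^ (n ∸ j)) i≡sj ⟨
        + power i * α ^ (n ∸ j)            ≈⟨ *-congʳ (α ^ (n ∸ j)) (power≈ i) ⟩
        α ^ i * α ^ (n ∸ j)                ≡⟨ ℤP.^-distribˡ-+-* α i (n ∸ j) ⟨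
        α ^ (i ℕ.+ (n ∸ j))                ∎
        where open ≈-Reasoning
      s≡ : s ≡ power (i ℕ.+ (n ∸ j))
      s≡ = residue-injective s<p (mod-< _) (≈-trans s≈ (≈-sym (power≈ (i ℕ.+ (n ∸ j)))))

  scale-disjoint : ∀ {s} → s ℕ.< p → ¬ (s ∈ μ) → ∀ {x y} → x ∈ μ → y ∈ scale p s μ → x ≢ y
  scale-disjoint {s} s<p s∉μ x∈μ y∈sμ refl
    with z , z∈μ , refl ← ∈-map⁻ (λ x → (s ℕ.* x) mod p) y∈sμ
    with i , _ , sz≡power-i ← ∈μ⇒power x∈μ
    with j , j<n , refl ← ∈μ⇒power z∈μ
    = s∉μ (scaled-power⇒∈μ s<p i j j<n (sym sz≡power-i))

  geometric-sum≈0 : ∀ k → 1 ℕ.≤ k → k ℕ.< n → sumBelow n ((α ^ k) ^_) ≈ 0ℤ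
  geometric-sum≈0 k 1≤k k<n = [ (λ α^k-1≈0 → ⊥-elim (α^k≉1 k 1≤k k<n (-≈0⇒≈ α^k-1≈0))) , (λ sum≈0 → sum≈0) ]′
                                (zero-product product≈0)
    where
    product≈0 : (α ^ k - 1ℤ) * sumBelow n ((α ^ k) ^_) ≈ 0ℤ
    product≈0 = begin
      (α ^ k - 1ℤ) * sumBelow n ((α ^ k) ^_) ≡⟨ geometric-sum (α ^ k) n ⟩
      (α ^ k) ^ n - 1ℤ                      ≡⟨ cong (_- 1ℤ) (^-comm α k n) ⟩
      (α ^ n) ^ k - 1ℤ                      ≈⟨ +-cong (^-cong k α^n≈1) ≈-refl ⟩
      1ℤ ^ k - 1ℤ                           ≡⟨ cong (_- 1ℤ) (ℤP.^-zeroˡ k) ⟩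
      1ℤ - 1ℤ                               ≡⟨ ℤP.+-inverseʳ 1ℤ ⟩
      0ℤ                                    ∎
      where open ≈-Reasoning

  powerSum-vanishes : ∀ (g : ℕ → ℕ) c → (∀ i → + g i ≈ c * α ^ i) →
                      ∀ k → 1 ℕ.≤ k → k ℕ.< n → powerSum k (map +_ (map g (upTo n))) ≈ 0ℤ
  powerSum-vanishes g c g≈ k 1≤k k<n = begin
    powerSum k (map +_ (map g (upTo n)))   ≡⟨ cong (powerSum k) (trans (sym (map-∘ (upTo n))) (map-upTo (+_ ∘ g) n)) ⟩
    powerSum k (applyUpTo (+_ ∘ g) n)      ≡⟨ powerSum-applyUpTo k (+_ ∘ g) n ⟩
    sumBelow n (λ i → (+ g i) ^ k)         ≈⟨ sumBelow-cong≈ n (λ i _ → term≈ i) ⟩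
    sumBelow n (λ i → c ^ k * (α ^ k) ^ i) ≡⟨ sumBelow-*ˡ n (c ^ k) ((α ^ k) ^_) ⟩
    c ^ k * sumBelow n ((α ^ k) ^_)        ≈⟨ *-congˡ (c ^ k) (geometric-sum≈0 k 1≤k k<n) ⟩
    c ^ k * 0ℤ                             ≡⟨ ℤP.*-zeroʳ (c ^ k) ⟩
    0ℤ                                     ∎
    where
    open ≈-Reasoning
    term≈ : ∀ i → (+ g i) ^ k ≈ c ^ k * (α ^ k) ^ i
    term≈ i = begin
      (+ g i) ^ k          ≈⟨ ^-cong k (g≈ i) ⟩
      (c * α ^ i) ^ k      ≡⟨ ^-distribʳ-* c (α ^ i) k ⟩
      c ^ k * (α ^ i) ^ k  ≡⟨ cong (c ^ k *_) (^-comm α i k) ⟩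
      c ^ k * (α ^ k) ^ i  ∎

  scale-symmetricIdealPTE : 2 ℕD.∣ n → ∀ {s} → s ℕ.< p → ¬ (s ∈ μ) → SymIdealPTE p n μ (scale p s μ)
  scale-symmetricIdealPTE 2∣n {s} s<p s∉μ = record
    { ideal = record
      { A-inFp   = μ<p
      ; B-inFp   = AllP.map⁺ (All.universal (λ x → mod-< (s ℕ.* x)) μ)
      ; sizeA    = length-μ
      ; sizeB    = trans (length-map _ μ) length-μ
      ; disjoint = scale-disjoint s<p s∉μ
      ; powers   = λ k 1≤k k<n → powSum-cong k {μ} {scale p s μ} (≈-trans (μ-vanishes k 1≤k k<n) (≈-sym (sμ-vanishes k 1≤k k<n)))
      }
    ; symA  = μ-symmetric 2∣n
    ; symB  = scale-symmetric 2∣n s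
    }
    where
    μ-vanishes : ∀ k → 1 ℕ.≤ k → k ℕ.< n → powerSum k (map +_ μ) ≈ 0ℤ
    μ-vanishes = powerSum-vanishes power 1ℤ (λ i → ≈-trans (power≈ i) (≈-reflexive (sym (ℤP.*-identityˡ (α ^ i)))))
    sμ-vanishes : ∀ k → 1 ℕ.≤ k → k ℕ.< n → powerSum k (map +_ (scale p s μ)) ≈ 0ℤ
    sμ-vanishes k 1≤k k<n = subst (λ xs → powerSum k (map +_ xs) ≈ 0ℤ) (map-∘ (upTo n))
      (powerSum-vanishes (λ i → (s ℕ.* power i) mod p) (+ s) scaled≈ k 1≤k k<n)
      where
      scaled≈ : ∀ i → + ((s ℕ.* power i) mod p) ≈ + s * α ^ i
      scaled≈ i = ≈-trans (mod-≈ (s ℕ.* power i)) (≈-trans (≈-reflexive (ℤP.pos-* s (power i))) (*-congˡ (+ s) (power≈ i)))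

  scale-representatives : 2 ℕD.∣ n → n ℕD.∣ p ∸ 1 →
    Σ (List ℕ) (λ S → (length S ℕ.* n ≡ p ∸ 1) × Unique S × (0 ∈ S) ×
      All (λ s → s ℕ.< p ∸ 1) S × All (λ s → SymIdealPTE p n μ (scale p s μ)) S)
  scale-representatives 2∣n (ℕD.divides r m≡r*n) =
    S , length-S , UniqueP.take⁺ r (UniqueP.filter⁺ ∉μ? (UniqueP.upTo⁺ m)) , 0∈S , AllP.take⁺ r (All.map proj₁ candidates-good) ,
    AllP.take⁺ r (All.map (λ (s<m , s∉μ) → scale-symmetricIdealPTE 2∣n (ℕP.<-≤-trans s<m (ℕP.m∸n≤m p 1)) s∉μ) candidates-good)
    where
    m = p ∸ 1
    ∉μ? = λ s → ¬? (s ∈? μ)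
    candidates = filter ∉μ? (upTo m)
    S = take r candidates
    candidates-good : All (λ s → s ℕ.< m × ¬ (s ∈ μ)) candidates
    candidates-good = All.zip (AllP.filter⁺ ∉μ? (AllP.applyUpTo⁺₁ (λ i → i) m (λ i<m → i<m)) , AllP.all-filter ∉μ? (upTo m))
    r≤|candidates| : r ℕ.≤ length candidates
    r≤|candidates| = avoiding-≥ μ length-μ (p∸1∈μ 2∣n) m≡r*n
    length-S : length S ℕ.* n ≡ m
    length-S = trans (cong (ℕ._* n) (trans (length-take r candidates) (ℕP.m≤n⇒m⊓n≡m r≤|candidates|))) (sym m≡r*n)
    1≤m : 1 ℕ.≤ m
    1≤m = ℕP.∸-monoˡ-≤ 1 1<p
    1≤r : 1 ℕ.≤ r
    1≤r = ℕP.n≢0⇒n>0 (λ r≡0 → ℕP.<⇒≢ 1≤m (sym (trans m≡r*n (cong (ℕ._* n) r≡0))))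
    0∈S : 0 ∈ S
    0∈S = 0∈take-filter-upTo ∉μ? 0∉μ 1≤r 1≤m

open import Data.Nat using (ℕ; _+_; _*_; _^_; _∸_; _<_; _≤_; _>_)
open import Data.Nat.Divisibility using (_∣_)
open import Data.Nat.Primality using (Prime)
open import Data.Integer using (+_)
open import Data.List using (List; _∷_; []; map; upTo; length)
open import Data.List.Relation.Unary.All using (All)
open import Data.List.Relation.Unary.Unique.Propositional using (Unique)
open import Data.List.Membership.Propositional using (_∈_)
open import Data.Product using (_×_; Σ)
open import Data.Sum using (_⊎_)
open import Relation.Binary.PropositionalEquality using (_≡_; _≢_)

theorem3p4 : (n p : ℕ) → 2 ≤ n → 2 ∣ n → Prime p →
    ((n ∣ (p ∸ 1) ⊎ n ∣ (p + 1)) → p > n + 1 →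
      (c₁ c₂ : ℕ) → c₁ < p → c₂ < p → c₁ ≢ c₂ →
      (A B : List ℕ) →
      RootMultisetSplit p (T n -ₚ (+ c₁ ∷ [])) A →
      RootMultisetSplit p (T n -ₚ (+ c₂ ∷ [])) B →
      SymIdealPTE p n A B)
    ×
    (n ∣ (p ∸ 1) → (a : ℕ) → HasOrder p a n →
      let A = map (λ i → (a ^ i) mod p) (upTo n) in
      Σ (List ℕ) (λ S → (length S * n ≡ p ∸ 1) × Unique S × (0 ∈ S) ×
        All (λ s → s < p ∸ 1) S × All (λ s → SymIdealPTE p n A (scale p s A)) S))
theorem3p4 n p 2≤n 2∣n p-prime =
  -- The congruence condition on p is what makes the level sets split in the paper; here the
  -- splitting is a hypothesis, so part (i) does not use it.
  (λ _ p>n+1 c₁ c₂ c₁<p c₂<p c₁≢c₂ A B →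
     chebyshev-symmetricIdealPTE p-prime (2<p p>n+1) 2∣n c₁<p c₂<p c₁≢c₂) ,
  (λ n∣p∸1 a order → RootsOfUnity.scale-representatives p-prime ⦃ n-nonZero ⦄ order 2∣n n∣p∸1)
  where
  2<p : p > n + 1 → 2 < p
  2<p = ℕP.<-trans (ℕP.≤-<-trans 2≤n (ℕP.m<m+n n (s≤s z≤n)))
  n-nonZero : ℕ.NonZero n
  n-nonZero = ℕ.>-nonZero (ℕP.<-≤-trans (s≤s z≤n) 2≤n)
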